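{- For all $n\ge1$, $H_n=\sum_{\lambda\vdash n}\sigma_{ -1}(\gcd(\lambda))\,m_\lambda$, where $\sigma_{ -1}(k)=\sum_{d\mid k}\frac1d$.
   Context: Symmetric functions over $\mathbb{Q}$ in variables $X=(x_1,x_2,\ldots)$; $p_\lambda$, $m_\lambda$ denote power sum and monomial symmetric functions. For a partition $\lambda$, $\ell(\lambda)$ is the number of parts, $\gcd(\lambda)$ the gcd of its parts, $z_\lambda=\prod_j m_j(\lambda)!\,j^{m_j(\lambda)}$ with $m_j(\lambda)$ the number of parts equal to $j$, and $\sigma_r(k)=\sum_{d\mid k}d^r$ for integers $r$. For $n\ge1$, $H_n=\sum_{\lambda\vdash n}\frac{\sigma_{\ell(\lambda)-1}(\gcd(\lambda))}{z_\lambda}p_\lambda$. -}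

module Defs where

open import Data.Nat as ℕ using (ℕ; zero; suc; _∸_; _≤?_)
open import Data.Nat.Properties using (≤-decTotalOrder)
open import Data.Nat.Divisibility using (_∣?_)
open import Data.Nat.GCD using (gcd)
open import Data.Nat using (_!)
open import Data.Nat.ListAction using (sum; product)
open import Data.Integer using (+_)
open import Data.Rational using (ℚ; 0ℚ; 1ℚ; _+_; _*_; _/_)
open import Data.Fin using (Fin)
open import Data.Vec as Vec using (Vec; []; _∷_)
import Data.Vec.Properties as VecP
open import Data.List as List using (List; []; _∷_; filter; foldr; map; concatMap; length)
import Data.List.Properties as ListP
open import Data.List.Sort.InsertionSort ≤-decTotalOrder using (sort)
open import Relation.Nullary using (Dec; yes; no; ¬?)
open import Relation.Nullary.Decidable using (⌊_⌋)
open import Relation.Binary.PropositionalEquality using (_≡_)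
open import Data.Bool using (Bool; true; false; if_then_else_)

toℚ : ℕ → ℚ
toℚ n = + n / 1

-- 1/n for n ≥ 1 (convention: 1/0 := 0; only used at positive arguments)
inv : ℕ → ℚ
inv zero    = 0ℚ
inv (suc k) = + 1 / suc k

[_] : ∀ {p} {P : Set p} → Dec P → ℚ
[ yes _ ] = 1ℚ
[ no  _ ] = 0ℚ

sumℚ : List ℚ → ℚ
sumℚ = foldr _+_ 0ℚ

divisors : ℕ → List ℕ
divisors k = filter (λ d → d ∣? k) (List.map suc (List.upTo k))

σ : ℕ → ℕ → ℕ
σ r k = sum (List.map (λ d → d ℕ.^ r) (divisors k))

σ₋₁ : ℕ → ℚ
σ₋₁ k = sumℚ (List.map inv (divisors k))

-- Partitions, represented as weakly decreasing lists of positive parts.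

-- parts f n b : all partitions of n with all parts ≤ b (fuel f ≥ n)
parts : ℕ → ℕ → ℕ → List (List ℕ)
parts _       zero    b = [] ∷ []
parts zero    (suc n) b = []
parts (suc f) (suc n) b =
  concatMap (λ j → map (j ∷_) (parts f (suc n ∸ j) j))
            (filter (λ j → j ≤? suc n) (List.map suc (List.upTo b)))

Partitions : ℕ → List (List ℕ)
Partitions n = parts n n n

size : List ℕ → ℕ
size = sum

len : List ℕ → ℕ
len = length

gcdL : List ℕ → ℕ
gcdL = foldr gcd 0

mult : ℕ → List ℕ → ℕ
mult j λs = length (filter (λ x → x ℕ.≟ j) λs)

z : List ℕ → ℕ
z λs = product
  (List.map (λ j → (mult j λs) ! ℕ.* (j ℕ.^ mult j λs))
            (List.map suc (List.upTo (size λs))))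

-- Symmetric functions, represented by their monomial coefficients.
-- An element of Λ is a formal power series in x₁, x₂, …; it is determined
-- by its coefficients at all monomials x^α, and every monomial involves
-- only finitely many variables.  So we represent the coefficient of
-- x₁^{α₁} ⋯ x_N^{α_N} (all other exponents 0) by a function on Vec ℕ N.

Ser : ℕ → Set
Ser N = Vec ℕ N → ℚ

below : ∀ {N} → Vec ℕ N → List (Vec ℕ N)
below []      = [] ∷ []
below (a ∷ α) = concatMap (λ b → map (b ∷_) (below α)) (List.upTo (suc a))

_⊛_ : ∀ {N} → Ser N → Ser N → Ser N
(f ⊛ g) α = sumℚ (map (λ β → f β * g (Vec.zipWith _∸_ α β)) (below α))

_⊕_ : ∀ {N} → Ser N → Ser N → Ser N
(f ⊕ g) α = f α + g α

_·_ : ∀ {N} → ℚ → Ser N → Ser N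
(c · f) α = c * f α

zeroS : ∀ {N} → Ser N
zeroS _ = 0ℚ

oneS : ∀ {N} → Ser N
oneS {N} α = [ VecP.≡-dec ℕ._≟_ α (Vec.replicate N 0) ]

unitExp : ∀ {N} → Fin N → ℕ → Vec ℕ N
unitExp {N} j k = Vec.updateAt (Vec.replicate N 0) j (λ _ → k)

p : ∀ {N} → ℕ → Ser N
p {N} k α = sumℚ (map (λ j → [ VecP.≡-dec ℕ._≟_ α (unitExp j k) ]) (List.allFin N))

pL : ∀ {N} → List ℕ → Ser N
pL λs = foldr (λ k acc → p k ⊛ acc) oneS λs

m : ∀ {N} → List ℕ → Ser N
m λs α = [ ListP.≡-dec ℕ._≟_ (sort (filter (λ x → ¬? (x ℕ.≟ 0)) (Vec.toList α))) (sort λs) ]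

sumS : ∀ {N} → List (Ser N) → Ser N
sumS = foldr _⊕_ zeroS

H : ∀ {N} → ℕ → Ser N
H n = sumS (map (λ λs → (toℚ (σ (len λs ∸ 1) (gcdL λs)) * inv (z λs)) · pL λs)
                (Partitions n))

Mexp : ∀ {N} → ℕ → Ser N
Mexp n = sumS (map (λ λs → σ₋₁ (gcdL λs) · m λs) (Partitions n))

{-# OPTIONS --safe #-}
-- Expanding σ_{ℓ-1}(g) = Σ_{d ∣ g} d^{ℓ-1} and σ_{-1}(g) = Σ_{d ∣ g} 1/d turns both sides into
-- Σ_{d ≤ n} (1/d)·(…), and the d-th terms agree coefficientwise.  On the H side the d-th term is
-- Σ_λ c(λ)/z_λ p_λ with c(j) = d [d ∣ j], the degree-n part of exp(Σ_j c(j) p_j / j) = ∏_v 1/(1 - x_v^d),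
-- whose coefficient at x^α is [|α| = n] [d divides every α_v].  On the M side the d-th term is
-- Σ_{d ∣ gcd λ} m_λ, with the same coefficient.  The exponential formula is proved one coefficient
-- at a time: the Euler operator x_v ∂/∂x_v turns it into the recurrence a e(a) = Σ_j c(j) e(a - j)
-- for the one-variable factor e.
module Submission where

open import Defs
open import Data.Nat as ℕ using (ℕ; zero; suc; _∸_; _≤_; _<_; _≤?_; _≟_; _^_; _!; z≤n; s≤s)
import Data.Nat.Properties as ℕP
import Data.Nat.Tactic.RingSolver as ℕ-Solver
open import Data.Nat.Divisibility using (_∣_; _∣?_; divides; _∣0; ∣⇒≤; ∣-trans; ∣-refl; ∣m+n∣m⇒∣n; ∣m∸n∣n⇒∣m; ∣m∣n⇒∣m+n)
open import Data.Nat.GCD using (gcd[m,n]∣m; gcd[m,n]∣n; gcd-greatest; gcd[m,n]≡0⇒m≡0)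
open import Data.Nat.Induction using (<-rec)
open import Data.Nat.ListAction using (sum; product)
import Data.Nat.ListAction.Properties as ListActionP
import Data.Integer as ℤ
import Data.Integer.Properties as ℤP
open import Data.Rational using (ℚ; 0ℚ; 1ℚ; _+_; _*_; fromℚᵘ)
open import Data.Rational.Properties as ℚP using (+-*-commutativeRing; toℚᵘ-injective; toℚᵘ-fromℚᵘ; fromℚᵘ-cong)
import Data.Rational.Unnormalised as ℚᵘ
import Data.Rational.Unnormalised.Properties as ℚᵘP
open import Data.Fin as Fin using (Fin; zero; suc)
import Data.Fin.Properties as FinP
open import Data.List using (List; []; _∷_; _++_; map; concatMap; filter; upTo; applyUpTo; allFin; tabulate; replicate; length)
import Data.List.Properties as ListP
open import Data.List.Relation.Unary.All as All using (All; []; _∷_)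
import Data.List.Relation.Unary.All.Properties as AllP
open import Data.List.Relation.Unary.Linked using ([]; [-]; _∷_)
open import Data.List.Relation.Unary.Sorted.TotalOrder using (Sorted)
import Data.List.Relation.Unary.Sorted.TotalOrder.Properties as SortedP
open import Data.List.Relation.Binary.Pointwise using (Pointwise-≡⇒≡)
open import Data.List.Relation.Binary.Permutation.Propositional using (_↭_; ↭-sym; ↭-trans; ↭⇒↭ₛ)
import Data.List.Relation.Binary.Permutation.Propositional.Properties as PermP
open import Data.List.Sort.InsertionSort ℕP.≤-decTotalOrder using (sort)
import Data.List.Sort.InsertionSort as InsertionSort
import Data.List.Sort.InsertionSort.Properties as InsertionSortP
open import Data.Vec as Vec using (Vec; []; _∷_; lookup; zipWith; updateAt; toList)
import Data.Vec.Properties as VecP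
open import Data.Product using (Σ; _×_; _,_; proj₁; proj₂)
open import Data.Unit using (⊤; tt)
open import Data.Empty using (⊥-elim)
open import Function using (_∘_; id; _⇔_; mk⇔; Equivalence)
open import Relation.Nullary using (Dec; yes; no; ¬_; ¬?)
open import Relation.Nullary.Decidable using (dec⇒maybe)
open import Relation.Unary using (Decidable)
open import Relation.Binary.Bundles using (DecTotalOrder)
open import Relation.Binary.Properties.DecTotalOrder ℕP.≤-decTotalOrder using (≥-decTotalOrder)
open import Relation.Binary.PropositionalEquality hiding ([_])
open import Tactic.RingSolver using (solve-∀)
open import Tactic.RingSolver.Core.AlmostCommutativeRing using (AlmostCommutativeRing; fromCommutativeRing)

ℚ-ring : AlmostCommutativeRing _ _
ℚ-ring = fromCommutativeRing +-*-commutativeRing (λ x → dec⇒maybe (ℚP._≟_ 0ℚ x))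

fromℚᵘ-+ : ∀ p q → fromℚᵘ (p ℚᵘ.+ q) ≡ fromℚᵘ p + fromℚᵘ q
fromℚᵘ-+ p q = toℚᵘ-injective (ℚᵘP.≃-trans (toℚᵘ-fromℚᵘ _) (ℚᵘP.≃-sym
  (ℚᵘP.≃-trans (ℚP.toℚᵘ-homo-+ (fromℚᵘ p) (fromℚᵘ q)) (ℚᵘP.+-cong (toℚᵘ-fromℚᵘ p) (toℚᵘ-fromℚᵘ q)))))

fromℚᵘ-* : ∀ p q → fromℚᵘ (p ℚᵘ.* q) ≡ fromℚᵘ p * fromℚᵘ q
fromℚᵘ-* p q = toℚᵘ-injective (ℚᵘP.≃-trans (toℚᵘ-fromℚᵘ _) (ℚᵘP.≃-sym
  (ℚᵘP.≃-trans (ℚP.toℚᵘ-homo-* (fromℚᵘ p) (fromℚᵘ q)) (ℚᵘP.*-cong (toℚᵘ-fromℚᵘ p) (toℚᵘ-fromℚᵘ q)))))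

private
  ι : ℕ → ℚᵘ.ℚᵘ
  ι n = ℚᵘ.mkℚᵘ (ℤ.+ n) 0

toℚ-+ : ∀ m n → toℚ (m ℕ.+ n) ≡ toℚ m + toℚ n
toℚ-+ m n = trans (fromℚᵘ-cong {ι (m ℕ.+ n)} {ι m ℚᵘ.+ ι n} (ℚᵘ.*≡* eq)) (fromℚᵘ-+ (ι m) (ι n))
  where
  eq : ℤ.+ (m ℕ.+ n) ℤ.* ℤ.1ℤ ≡ (ℤ.+ m ℤ.* ℤ.1ℤ ℤ.+ ℤ.+ n ℤ.* ℤ.1ℤ) ℤ.* ℤ.1ℤ
  eq = begin
    ℤ.+ (m ℕ.+ n) ℤ.* ℤ.1ℤ                        ≡⟨ ℤP.*-identityʳ _ ⟩
    ℤ.+ m ℤ.+ ℤ.+ n                               ≡⟨ cong₂ ℤ._+_ (sym (ℤP.*-identityʳ (ℤ.+ m))) (sym (ℤP.*-identityʳ (ℤ.+ n))) ⟩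
    ℤ.+ m ℤ.* ℤ.1ℤ ℤ.+ ℤ.+ n ℤ.* ℤ.1ℤ             ≡⟨ sym (ℤP.*-identityʳ _) ⟩
    (ℤ.+ m ℤ.* ℤ.1ℤ ℤ.+ ℤ.+ n ℤ.* ℤ.1ℤ) ℤ.* ℤ.1ℤ  ∎
    where open ≡-Reasoning

toℚ-* : ∀ m n → toℚ (m ℕ.* n) ≡ toℚ m * toℚ n
toℚ-* m n = trans (fromℚᵘ-cong {ι (m ℕ.* n)} {ι m ℚᵘ.* ι n} (ℚᵘ.*≡* (cong (ℤ._* ℤ.1ℤ) (ℤP.pos-* m n))))
                  (fromℚᵘ-* (ι m) (ι n))

toℚ-inverse : ∀ n → toℚ (suc n) * inv (suc n) ≡ 1ℚ
toℚ-inverse n = trans (sym (fromℚᵘ-* (ι (suc n)) (ℚᵘ.mkℚᵘ ℤ.1ℤ n)))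
  (fromℚᵘ-cong {ι (suc n) ℚᵘ.* ℚᵘ.mkℚᵘ ℤ.1ℤ n} {ι 1} (ℚᵘ.*≡* eq))
  where
  eq : (ℤ.+ suc n ℤ.* ℤ.1ℤ) ℤ.* ℤ.1ℤ ≡ ℤ.1ℤ ℤ.* ℤ.+ (1 ℕ.* suc n)
  eq = trans (ℤP.*-identityʳ _) (trans (ℤP.*-identityʳ _)
         (sym (trans (ℤP.*-identityˡ _) (cong ℤ.+_ (ℕP.*-identityˡ (suc n))))))

inv-* : ∀ m n → 1 ≤ m → 1 ≤ n → inv (m ℕ.* n) ≡ inv m * inv n
inv-* (suc m) (suc n) _ _ = fromℚᵘ-* (ℚᵘ.mkℚᵘ ℤ.1ℤ m) (ℚᵘ.mkℚᵘ ℤ.1ℤ n)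

toℚ-cancelˡ : ∀ n {x y} → toℚ (suc n) * x ≡ toℚ (suc n) * y → x ≡ y
toℚ-cancelˡ n {x} {y} eq = begin
  x                               ≡⟨ sym (cancel x) ⟩
  inv (suc n) * (toℚ (suc n) * x) ≡⟨ cong (inv (suc n) *_) eq ⟩
  inv (suc n) * (toℚ (suc n) * y) ≡⟨ cancel y ⟩
  y                               ∎
  where
  open ≡-Reasoning
  cancel : ∀ z → inv (suc n) * (toℚ (suc n) * z) ≡ z
  cancel z = begin
    inv (suc n) * (toℚ (suc n) * z) ≡⟨ sym (ℚP.*-assoc (inv (suc n)) (toℚ (suc n)) z) ⟩
    (inv (suc n) * toℚ (suc n)) * z ≡⟨ cong (_* z) (trans (ℚP.*-comm (inv (suc n)) (toℚ (suc n))) (toℚ-inverse n)) ⟩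
    1ℚ * z                          ≡⟨ ℚP.*-identityˡ z ⟩
    z                               ∎

∑ : {A : Set} → List A → (A → ℚ) → ℚ
∑ []       f = 0ℚ
∑ (x ∷ xs) f = f x + ∑ xs f

sumℚ-map : {A : Set} (f : A → ℚ) (xs : List A) → sumℚ (map f xs) ≡ ∑ xs f
sumℚ-map f []       = refl
sumℚ-map f (x ∷ xs) = cong (f x +_) (sumℚ-map f xs)

module _ {A : Set} where

  ∑-cong : (xs : List A) {f g : A → ℚ} → (∀ x → f x ≡ g x) → ∑ xs f ≡ ∑ xs g
  ∑-cong []       f≗g = refl
  ∑-cong (x ∷ xs) f≗g = cong₂ _+_ (f≗g x) (∑-cong xs f≗g)

  ∑-cong-All : {xs : List A} {f g : A → ℚ} → All (λ x → f x ≡ g x) xs → ∑ xs f ≡ ∑ xs g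
  ∑-cong-All []         = refl
  ∑-cong-All (eq ∷ eqs) = cong₂ _+_ eq (∑-cong-All eqs)

  ∑-zero : (xs : List A) → ∑ xs (λ _ → 0ℚ) ≡ 0ℚ
  ∑-zero []       = refl
  ∑-zero (x ∷ xs) = trans (ℚP.+-identityˡ _) (∑-zero xs)

  ∑-+ : (xs : List A) (f g : A → ℚ) → ∑ xs (λ x → f x + g x) ≡ ∑ xs f + ∑ xs g
  ∑-+ []       f g = refl
  ∑-+ (x ∷ xs) f g = trans (cong (f x + g x +_) (∑-+ xs f g)) (medial (f x) (g x) (∑ xs f) (∑ xs g))
    where
    medial : ∀ a b c d → a + b + (c + d) ≡ a + c + (b + d)
    medial = solve-∀ ℚ-ring

  ∑-*ˡ : (c : ℚ) (xs : List A) (f : A → ℚ) → c * ∑ xs f ≡ ∑ xs (λ x → c * f x)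
  ∑-*ˡ c []       f = ℚP.*-zeroʳ c
  ∑-*ˡ c (x ∷ xs) f = trans (ℚP.*-distribˡ-+ c (f x) (∑ xs f)) (cong (c * f x +_) (∑-*ˡ c xs f))

  ∑-*ʳ : (c : ℚ) (xs : List A) (f : A → ℚ) → ∑ xs f * c ≡ ∑ xs (λ x → f x * c)
  ∑-*ʳ c xs f = trans (ℚP.*-comm (∑ xs f) c) (trans (∑-*ˡ c xs f) (∑-cong xs (λ x → ℚP.*-comm c (f x))))

  ∑-++ : (xs ys : List A) (f : A → ℚ) → ∑ (xs ++ ys) f ≡ ∑ xs f + ∑ ys f
  ∑-++ []       ys f = sym (ℚP.+-identityˡ _)
  ∑-++ (x ∷ xs) ys f = trans (cong (f x +_) (∑-++ xs ys f)) (sym (ℚP.+-assoc (f x) (∑ xs f) (∑ ys f)))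

  ∑-filter : {P : A → Set} (P? : Decidable P) (xs : List A) (f : A → ℚ) →
             ∑ (filter P? xs) f ≡ ∑ xs (λ x → [ P? x ] * f x)
  ∑-filter P? []       f = refl
  ∑-filter P? (x ∷ xs) f with P? x
  ... | yes _ = cong₂ _+_ (sym (ℚP.*-identityˡ (f x))) (∑-filter P? xs f)
  ... | no  _ = trans (∑-filter P? xs f) (sym (trans (cong (_+ _) (ℚP.*-zeroˡ (f x))) (ℚP.+-identityˡ _)))

module _ {A B : Set} where

  ∑-map : (g : A → B) (xs : List A) (f : B → ℚ) → ∑ (map g xs) f ≡ ∑ xs (f ∘ g)
  ∑-map g []       f = refl
  ∑-map g (x ∷ xs) f = cong (f (g x) +_) (∑-map g xs f)

  ∑-concatMap : (g : A → List B) (xs : List A) (f : B → ℚ) →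
                ∑ (concatMap g xs) f ≡ ∑ xs (λ x → ∑ (g x) f)
  ∑-concatMap g []       f = refl
  ∑-concatMap g (x ∷ xs) f = trans (∑-++ (g x) (concatMap g xs) f) (cong (∑ (g x) f +_) (∑-concatMap g xs f))

  ∑-comm : (xs : List A) (ys : List B) (f : A → B → ℚ) →
           ∑ xs (λ x → ∑ ys (f x)) ≡ ∑ ys (λ y → ∑ xs (λ x → f x y))
  ∑-comm []       ys f = sym (∑-zero ys)
  ∑-comm (x ∷ xs) ys f = trans (cong (∑ ys (f x) +_) (∑-comm xs ys f)) (sym (∑-+ ys (f x) _))

∑-∑-* : {A B : Set} (xs : List A) (ys : List B) (a : B → ℚ) (f : A → B → ℚ) (g : A → ℚ) →
  ∑ xs (λ x → ∑ ys (λ y → a y * f x y) * g x) ≡ ∑ ys (λ y → a y * ∑ xs (λ x → f x y * g x))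
∑-∑-* xs ys a f g = begin
  ∑ xs (λ x → ∑ ys (λ y → a y * f x y) * g x)     ≡⟨ ∑-cong xs (λ x → ∑-*ʳ (g x) ys (λ y → a y * f x y)) ⟩
  ∑ xs (λ x → ∑ ys (λ y → (a y * f x y) * g x))   ≡⟨ ∑-comm xs ys (λ x y → (a y * f x y) * g x) ⟩
  ∑ ys (λ y → ∑ xs (λ x → (a y * f x y) * g x))   ≡⟨ ∑-cong ys (λ y → trans (∑-cong xs (λ x → ℚP.*-assoc (a y) (f x y) (g x))) (sym (∑-*ˡ (a y) xs (λ x → f x y * g x)))) ⟩
  ∑ ys (λ y → a y * ∑ xs (λ x → f x y * g x))     ∎
  where open ≡-Reasoning

∑-applyUpTo : (g : ℕ → ℕ) (n : ℕ) (f : ℕ → ℚ) → ∑ (applyUpTo g n) f ≡ ∑ (upTo n) (f ∘ g)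
∑-applyUpTo g zero    f = refl
∑-applyUpTo g (suc n) f = cong (f (g 0) +_)
  (trans (∑-applyUpTo (g ∘ suc) n f) (sym (∑-applyUpTo suc n (f ∘ g))))

∑-upTo-suc : (n : ℕ) (f : ℕ → ℚ) → ∑ (upTo (suc n)) f ≡ f 0 + ∑ (upTo n) (f ∘ suc)
∑-upTo-suc n f = cong (f 0 +_) (∑-applyUpTo suc n f)

∑-upTo-+ : ∀ m n (f : ℕ → ℚ) → ∑ (upTo (m ℕ.+ n)) f ≡ ∑ (upTo m) f + ∑ (upTo n) (λ i → f (m ℕ.+ i))
∑-upTo-+ zero    n f = sym (ℚP.+-identityˡ _)
∑-upTo-+ (suc m) n f = begin
  ∑ (upTo (suc (m ℕ.+ n))) f                                             ≡⟨ ∑-upTo-suc (m ℕ.+ n) f ⟩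
  f 0 + ∑ (upTo (m ℕ.+ n)) (f ∘ suc)                                     ≡⟨ cong (f 0 +_) (∑-upTo-+ m n (f ∘ suc)) ⟩
  f 0 + (∑ (upTo m) (f ∘ suc) + ∑ (upTo n) (λ i → f (suc m ℕ.+ i)))      ≡⟨ sym (ℚP.+-assoc (f 0) _ _) ⟩
  (f 0 + ∑ (upTo m) (f ∘ suc)) + ∑ (upTo n) (λ i → f (suc m ℕ.+ i))      ≡⟨ cong (_+ ∑ (upTo n) (λ i → f (suc m ℕ.+ i))) (sym (∑-upTo-suc m f)) ⟩
  ∑ (upTo (suc m)) f + ∑ (upTo n) (λ i → f (suc m ℕ.+ i))                ∎
  where open ≡-Reasoning

∑-upTo-last : (n : ℕ) (f : ℕ → ℚ) → ∑ (upTo (suc n)) f ≡ ∑ (upTo n) f + f n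
∑-upTo-last n f = begin
  ∑ (upTo (suc n)) f               ≡⟨ cong (λ k → ∑ (upTo k) f) (ℕP.+-comm 1 n) ⟩
  ∑ (upTo (n ℕ.+ 1)) f             ≡⟨ ∑-upTo-+ n 1 f ⟩
  ∑ (upTo n) f + (f (n ℕ.+ 0) + 0ℚ) ≡⟨ cong (∑ (upTo n) f +_) (trans (ℚP.+-identityʳ _) (cong f (ℕP.+-identityʳ n))) ⟩
  ∑ (upTo n) f + f n               ∎
  where open ≡-Reasoning

∑-upTo-cong : ∀ n {f g : ℕ → ℚ} → (∀ {i} → i < n → f i ≡ g i) → ∑ (upTo n) f ≡ ∑ (upTo n) g
∑-upTo-cong n f≗g = ∑-cong-All (AllP.applyUpTo⁺₁ (λ i → i) n f≗g)

∑-upTo-vanishing : ∀ m n (f : ℕ → ℚ) → (∀ i → m ≤ i → f i ≡ 0ℚ) → m ≤ n → ∑ (upTo n) f ≡ ∑ (upTo m) f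
∑-upTo-vanishing m n f f≡0 m≤n = begin
  ∑ (upTo n) f                                   ≡⟨ cong (λ k → ∑ (upTo k) f) (sym (ℕP.m+[n∸m]≡n m≤n)) ⟩
  ∑ (upTo (m ℕ.+ (n ∸ m))) f                     ≡⟨ ∑-upTo-+ m (n ∸ m) f ⟩
  ∑ (upTo m) f + ∑ (upTo (n ∸ m)) (λ i → f (m ℕ.+ i)) ≡⟨ cong (∑ (upTo m) f +_) (trans (∑-cong (upTo (n ∸ m)) (λ i → f≡0 (m ℕ.+ i) (ℕP.m≤m+n m i))) (∑-zero (upTo (n ∸ m)))) ⟩
  ∑ (upTo m) f + 0ℚ                              ≡⟨ ℚP.+-identityʳ _ ⟩
  ∑ (upTo m) f                                   ∎
  where open ≡-Reasoning

∑-tabulate : ∀ {N} {B : Set} (g : Fin N → B) (f : B → ℚ) → ∑ (tabulate g) f ≡ ∑ (allFin N) (f ∘ g)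
∑-tabulate {zero}  g f = refl
∑-tabulate {suc N} g f = cong (f (g zero) +_) (trans (∑-tabulate (g ∘ suc) f) (sym (∑-tabulate suc (f ∘ g))))

∑-allFin-suc : ∀ N (f : Fin (suc N) → ℚ) → ∑ (allFin (suc N)) f ≡ f zero + ∑ (allFin N) (f ∘ suc)
∑-allFin-suc N f = cong (f zero +_) (∑-tabulate suc f)

module _ {P : Set} where

  iverson-yes : (d : Dec P) → P → [ d ] ≡ 1ℚ
  iverson-yes (yes _) _  = refl
  iverson-yes (no ¬p) p = ⊥-elim (¬p p)

  iverson-no : (d : Dec P) → ¬ P → [ d ] ≡ 0ℚ
  iverson-no (yes p) ¬p = ⊥-elim (¬p p)
  iverson-no (no _)  _  = refl

  iverson-guard : (d : Dec P) {x y : ℚ} → (P → x ≡ y) → [ d ] * x ≡ [ d ] * y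
  iverson-guard (yes p) x≡y = cong (1ℚ *_) (x≡y p)
  iverson-guard (no _)  {x} {y} _ = trans (ℚP.*-zeroˡ x) (sym (ℚP.*-zeroˡ y))

  iverson-⇔ : {Q : Set} (d : Dec P) (d′ : Dec Q) → P ⇔ Q → [ d ] ≡ [ d′ ]
  iverson-⇔ (yes _) (yes _) _   = refl
  iverson-⇔ (no _)  (no _)  _   = refl
  iverson-⇔ (yes p) (no ¬q) P⇔Q = ⊥-elim (¬q (Equivalence.to P⇔Q p))
  iverson-⇔ (no ¬p) (yes q) P⇔Q = ⊥-elim (¬p (Equivalence.from P⇔Q q))

  iverson-× : {Q R : Set} (d : Dec P) (d₁ : Dec Q) (d₂ : Dec R) → P ⇔ (Q × R) → [ d ] ≡ [ d₁ ] * [ d₂ ]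
  iverson-× (yes p) (yes _) (yes _) _     = refl
  iverson-× (yes p) (no ¬q) _       P⇔QR = ⊥-elim (¬q (proj₁ (Equivalence.to P⇔QR p)))
  iverson-× (yes p) (yes _) (no ¬r) P⇔QR = ⊥-elim (¬r (proj₂ (Equivalence.to P⇔QR p)))
  iverson-× (no ¬p) (yes q) (yes r) P⇔QR = ⊥-elim (¬p (Equivalence.from P⇔QR (q , r)))
  iverson-× (no _)  (no _)  d₂      _     = sym (ℚP.*-zeroˡ [ d₂ ])
  iverson-× (no _)  (yes _) (no _)  _     = refl

iverson-≡ : {A : Set} {x y : A} (d : Dec (x ≡ y)) (f : A → ℚ) → [ d ] * f x ≡ [ d ] * f y
iverson-≡ d f = iverson-guard d (cong f)

iverson-absorb : ∀ {P Q : Set} (d : Dec P) (d′ : Dec Q) → (Q → P) → ∀ x y → [ d ] * (x * ([ d′ ] * y)) ≡ [ d′ ] * (x * y)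
iverson-absorb d       (no _)  _   x y = trans (cong (λ t → [ d ] * t) (trans (cong (x *_) (ℚP.*-zeroˡ y)) (ℚP.*-zeroʳ x))) (trans (ℚP.*-zeroʳ [ d ]) (sym (ℚP.*-zeroˡ (x * y))))
iverson-absorb d       (yes q) Q→P x y = trans (cong₂ (λ s t → s * (x * t)) (iverson-yes d (Q→P q)) (ℚP.*-identityˡ y)) refl

∑-allFin-δ : ∀ N (v : Fin N) (f : Fin N → ℚ) → ∑ (allFin N) (λ w → [ w Fin.≟ v ] * f w) ≡ f v
∑-allFin-δ (suc N) v f = begin
  ∑ (allFin (suc N)) (λ w → [ w Fin.≟ v ] * f w)                            ≡⟨ ∑-allFin-suc N (λ w → [ w Fin.≟ v ] * f w) ⟩
  [ zero Fin.≟ v ] * f zero + ∑ (allFin N) (λ w → [ suc w Fin.≟ v ] * f (suc w)) ≡⟨ split v ⟩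
  f v                                                                        ∎
  where
  open ≡-Reasoning
  split : ∀ v → [ zero Fin.≟ v ] * f zero + ∑ (allFin N) (λ w → [ suc w Fin.≟ v ] * f (suc w)) ≡ f v
  split zero = begin
    1ℚ * f zero + ∑ (allFin N) (λ w → 0ℚ * f (suc w)) ≡⟨ cong₂ _+_ (ℚP.*-identityˡ (f zero)) (trans (∑-cong (allFin N) (λ w → ℚP.*-zeroˡ (f (suc w)))) (∑-zero (allFin N))) ⟩
    f zero + 0ℚ                                        ≡⟨ ℚP.+-identityʳ (f zero) ⟩
    f zero                                             ∎
  split (suc v) = begin
    0ℚ * f zero + ∑ (allFin N) (λ w → [ suc w Fin.≟ suc v ] * f (suc w)) ≡⟨ trans (cong (_+ ∑ (allFin N) (λ w → [ suc w Fin.≟ suc v ] * f (suc w))) (ℚP.*-zeroˡ (f zero))) (ℚP.+-identityˡ _) ⟩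
    ∑ (allFin N) (λ w → [ suc w Fin.≟ suc v ] * f (suc w))              ≡⟨ ∑-cong (allFin N) (λ w → cong (_* f (suc w)) (iverson-⇔ (suc w Fin.≟ suc v) (w Fin.≟ v) (mk⇔ FinP.suc-injective (cong suc)))) ⟩
    ∑ (allFin N) (λ w → [ w Fin.≟ v ] * f (suc w))                      ≡⟨ ∑-allFin-δ N v (f ∘ suc) ⟩
    f (suc v)                                                            ∎

∑-upTo-δ : ∀ a c → ∑ (upTo (suc a)) (λ b → [ b ℕ.≟ c ]) ≡ [ c ≤? a ]
∑-upTo-δ zero    zero    = refl
∑-upTo-δ zero    (suc c) = refl
∑-upTo-δ (suc a) zero    = trans (∑-upTo-suc (suc a) (λ b → [ b ℕ.≟ 0 ])) (cong (1ℚ +_) (trans (∑-cong (upTo (suc a)) (λ b → iverson-no (suc b ℕ.≟ 0) (λ ()))) (∑-zero (upTo (suc a)))))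
∑-upTo-δ (suc a) (suc c) = begin
  ∑ (upTo (suc (suc a))) (λ b → [ b ℕ.≟ suc c ]) ≡⟨ trans (∑-upTo-suc (suc a) (λ b → [ b ℕ.≟ suc c ])) (ℚP.+-identityˡ _) ⟩
  ∑ (upTo (suc a)) (λ b → [ suc b ℕ.≟ suc c ])   ≡⟨ ∑-cong (upTo (suc a)) (λ b → iverson-⇔ (suc b ℕ.≟ suc c) (b ℕ.≟ c) (mk⇔ ℕP.suc-injective (cong suc))) ⟩
  ∑ (upTo (suc a)) (λ b → [ b ℕ.≟ c ])           ≡⟨ ∑-upTo-δ a c ⟩
  [ c ≤? a ]                                     ≡⟨ iverson-⇔ (c ≤? a) (suc c ≤? suc a) (mk⇔ s≤s ℕ.s≤s⁻¹) ⟩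
  [ suc c ≤? suc a ]                             ∎
  where open ≡-Reasoning

∸-comm : ∀ m n o → m ∸ n ∸ o ≡ m ∸ o ∸ n
∸-comm m n o = trans (ℕP.∸-+-assoc m n o) (trans (cong (m ∸_) (ℕP.+-comm n o)) (sym (ℕP.∸-+-assoc m o n)))

iverson-≤-∸ : ∀ j k b → [ j ≤? b ] * [ k ≤? b ∸ j ] ≡ [ k ℕ.+ j ≤? b ]
iverson-≤-∸ j k b = sym (iverson-× (k ℕ.+ j ≤? b) (j ≤? b) (k ≤? b ∸ j)
  (mk⇔ (λ k+j≤b → ℕP.m+n≤o⇒n≤o k k+j≤b , ℕP.m+n≤o⇒m≤o∸n k k+j≤b) (λ (j≤b , k≤b∸j) → ℕP.m≤o∸n⇒m+n≤o k j≤b k≤b∸j)))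

iverson-≤-∸-comm : ∀ j k b → [ j ≤? b ] * [ k ≤? b ∸ j ] ≡ [ k ≤? b ] * [ j ≤? b ∸ k ]
iverson-≤-∸-comm j k b = begin
  [ j ≤? b ] * [ k ≤? b ∸ j ] ≡⟨ iverson-≤-∸ j k b ⟩
  [ k ℕ.+ j ≤? b ]            ≡⟨ cong (λ t → [ t ≤? b ]) (ℕP.+-comm k j) ⟩
  [ j ℕ.+ k ≤? b ]            ≡⟨ sym (iverson-≤-∸ k j b) ⟩
  [ k ≤? b ] * [ j ≤? b ∸ k ] ∎
  where open ≡-Reasoning

∑-upTo-truncate : ∀ n b (f : ℕ → ℚ) → n ≤ b → ∑ (upTo b) (λ i → [ suc i ≤? n ] * f i) ≡ ∑ (upTo n) f
∑-upTo-truncate n b f n≤b = begin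
  ∑ (upTo b) (λ i → [ suc i ≤? n ] * f i) ≡⟨ ∑-upTo-vanishing n b _ (λ i n≤i → trans (cong (_* f i) (iverson-no (suc i ≤? n) (λ i<n → ℕP.<-irrefl refl (ℕP.<-≤-trans i<n n≤i)))) (ℚP.*-zeroˡ (f i))) n≤b ⟩
  ∑ (upTo n) (λ i → [ suc i ≤? n ] * f i) ≡⟨ ∑-upTo-cong n (λ {i} i<n → trans (cong (_* f i) (iverson-yes (suc i ≤? n) i<n)) (ℚP.*-identityˡ (f i))) ⟩
  ∑ (upTo n) f                            ∎
  where open ≡-Reasoning

lowerAt : ∀ {N} → Vec ℕ N → Fin N → ℕ → Vec ℕ N
lowerAt α v k = updateAt α v (_∸ k)

-- Coefficient of x^α in p_μ: a monomial of p_μ sends each part of μ to one variable.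
pCoeff : ∀ {N} → List ℕ → Vec ℕ N → ℚ
pCoeff     []      α = oneS α
pCoeff {N} (k ∷ μ) α = ∑ (allFin N) (λ v → [ k ≤? lookup α v ] * pCoeff μ (lowerAt α v k))

_≟ᵛ_ : ∀ {N} (x y : Vec ℕ N) → Dec (x ≡ y)
_≟ᵛ_ = VecP.≡-dec _≟_

iverson-≟ᵛ-∷ : ∀ {N} b c (β γ : Vec ℕ N) → [ (b ∷ β) ≟ᵛ (c ∷ γ) ] ≡ [ b ≟ c ] * [ β ≟ᵛ γ ]
iverson-≟ᵛ-∷ b c β γ = iverson-× ((b ∷ β) ≟ᵛ (c ∷ γ)) (b ≟ c) (β ≟ᵛ γ)
  (mk⇔ VecP.∷-injective (λ (b≡c , β≡γ) → cong₂ _∷_ b≡c β≡γ))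

∑-below-δ-∷ : ∀ {N} a (α : Vec ℕ N) c γ →
  ∑ (below (a ∷ α)) (λ β → [ β ≟ᵛ (c ∷ γ) ]) ≡ [ c ≤? a ] * ∑ (below α) (λ β → [ β ≟ᵛ γ ])
∑-below-δ-∷ a α c γ = begin
  ∑ (below (a ∷ α)) (λ β → [ β ≟ᵛ (c ∷ γ) ])
    ≡⟨ ∑-concatMap (λ b → map (b ∷_) (below α)) (upTo (suc a)) _ ⟩
  ∑ (upTo (suc a)) (λ b → ∑ (map (b ∷_) (below α)) (λ β → [ β ≟ᵛ (c ∷ γ) ]))
    ≡⟨ ∑-cong (upTo (suc a)) (λ b → ∑-map (b ∷_) (below α) _) ⟩
  ∑ (upTo (suc a)) (λ b → ∑ (below α) (λ β → [ (b ∷ β) ≟ᵛ (c ∷ γ) ]))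
    ≡⟨ ∑-cong (upTo (suc a)) (λ b → trans (∑-cong (below α) (λ β → iverson-≟ᵛ-∷ b c β γ)) (sym (∑-*ˡ [ b ≟ c ] (below α) _))) ⟩
  ∑ (upTo (suc a)) (λ b → [ b ≟ c ] * ∑ (below α) (λ β → [ β ≟ᵛ γ ]))
    ≡⟨ sym (∑-*ʳ _ (upTo (suc a)) (λ b → [ b ≟ c ])) ⟩
  ∑ (upTo (suc a)) (λ b → [ b ≟ c ]) * ∑ (below α) (λ β → [ β ≟ᵛ γ ])
    ≡⟨ cong (_* _) (∑-upTo-δ a c) ⟩
  [ c ≤? a ] * ∑ (below α) (λ β → [ β ≟ᵛ γ ]) ∎
  where open ≡-Reasoning

∑-below-δ-zeros : ∀ {N} (α : Vec ℕ N) → ∑ (below α) (λ β → [ β ≟ᵛ Vec.replicate N 0 ]) ≡ 1ℚ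
∑-below-δ-zeros []      = refl
∑-below-δ-zeros (a ∷ α) = trans (∑-below-δ-∷ a α 0 _) (cong (1ℚ *_) (∑-below-δ-zeros α))

∑-below-δ-unitExp : ∀ {N} (α : Vec ℕ N) j k → ∑ (below α) (λ β → [ β ≟ᵛ unitExp j k ]) ≡ [ k ≤? lookup α j ]
∑-below-δ-unitExp (a ∷ α) zero    k = trans (∑-below-δ-∷ a α k _) (trans (cong ([ k ≤? a ] *_) (∑-below-δ-zeros α)) (ℚP.*-identityʳ _))
∑-below-δ-unitExp (a ∷ α) (suc j) k = trans (∑-below-δ-∷ a α 0 _) (trans (cong (1ℚ *_) (∑-below-δ-unitExp α j k)) (ℚP.*-identityˡ _))

zipWith-∸-unitExp : ∀ {N} (α : Vec ℕ N) j k → zipWith _∸_ α (unitExp j k) ≡ lowerAt α j k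
zipWith-∸-unitExp (a ∷ α) zero    k = cong (a ∸ k ∷_) (trans (VecP.zipWith-replicate₂ _∸_ α 0) (VecP.map-id α))
zipWith-∸-unitExp (a ∷ α) (suc j) k = cong (a ∷_) (zipWith-∸-unitExp α j k)

p⊛-coeff : ∀ {N} k (G : Vec ℕ N → ℚ) (α : Vec ℕ N) →
  (p k ⊛ G) α ≡ ∑ (allFin N) (λ v → [ k ≤? lookup α v ] * G (lowerAt α v k))
p⊛-coeff {N} k G α = begin
  (p k ⊛ G) α
    ≡⟨ sumℚ-map _ (below α) ⟩
  ∑ (below α) (λ β → p k β * G (α ∸ᵛ β))
    ≡⟨ ∑-cong (below α) (λ β → trans (cong (_* G (α ∸ᵛ β)) (sumℚ-map _ (allFin N))) (∑-*ʳ _ (allFin N) _)) ⟩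
  ∑ (below α) (λ β → ∑ (allFin N) (λ v → [ β ≟ᵛ unitExp v k ] * G (α ∸ᵛ β)))
    ≡⟨ ∑-comm (below α) (allFin N) _ ⟩
  ∑ (allFin N) (λ v → ∑ (below α) (λ β → [ β ≟ᵛ unitExp v k ] * G (α ∸ᵛ β)))
    ≡⟨ ∑-cong (allFin N) (λ v → ∑-cong (below α) (λ β → iverson-≡ (β ≟ᵛ unitExp v k) (λ γ → G (α ∸ᵛ γ)))) ⟩
  ∑ (allFin N) (λ v → ∑ (below α) (λ β → [ β ≟ᵛ unitExp v k ] * G (α ∸ᵛ unitExp v k)))
    ≡⟨ ∑-cong (allFin N) (λ v → sym (∑-*ʳ _ (below α) _)) ⟩
  ∑ (allFin N) (λ v → ∑ (below α) (λ β → [ β ≟ᵛ unitExp v k ]) * G (α ∸ᵛ unitExp v k))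
    ≡⟨ ∑-cong (allFin N) (λ v → cong₂ _*_ (∑-below-δ-unitExp α v k) (cong G (zipWith-∸-unitExp α v k))) ⟩
  ∑ (allFin N) (λ v → [ k ≤? lookup α v ] * G (lowerAt α v k)) ∎
  where
  open ≡-Reasoning
  _∸ᵛ_ : Vec ℕ N → Vec ℕ N → Vec ℕ N
  _∸ᵛ_ = zipWith _∸_

pL≡pCoeff : ∀ {N} μ (α : Vec ℕ N) → pL μ α ≡ pCoeff μ α
pL≡pCoeff []      α = refl
pL≡pCoeff (k ∷ μ) α = trans (sumℚ-map _ (below α))
  (trans (∑-cong (below α) (λ β → cong (p k β *_) (pL≡pCoeff μ (zipWith _∸_ α β))))
         (trans (sym (sumℚ-map _ (below α))) (p⊛-coeff k (pCoeff μ) α)))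

-- Σ_j j · F j (μ ∖ j) over the parts j of μ: the shape of x_v ∂/∂x_v applied to the product p_μ.
removeSum : List ℕ → (ℕ → List ℕ → ℚ) → ℚ
removeSum []      F = 0ℚ
removeSum (k ∷ μ) F = toℚ k * F k μ + removeSum μ (λ j ν → F j (k ∷ ν))

removeSum-cong : ∀ μ {F G : ℕ → List ℕ → ℚ} → (∀ j ν → F j ν ≡ G j ν) → removeSum μ F ≡ removeSum μ G
removeSum-cong []      F≗G = refl
removeSum-cong (k ∷ μ) F≗G = cong₂ _+_ (cong (toℚ k *_) (F≗G k μ)) (removeSum-cong μ (λ j ν → F≗G j (k ∷ ν)))

removeSum-+ : ∀ μ (F G : ℕ → List ℕ → ℚ) → removeSum μ (λ j ν → F j ν + G j ν) ≡ removeSum μ F + removeSum μ G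
removeSum-+ []      F G = refl
removeSum-+ (k ∷ μ) F G = trans
  (cong₂ _+_ (ℚP.*-distribˡ-+ (toℚ k) (F k μ) (G k μ)) (removeSum-+ μ _ _))
  (medial (toℚ k * F k μ) (toℚ k * G k μ) _ _)
  where
  medial : ∀ a b c d → (a + b) + (c + d) ≡ (a + c) + (b + d)
  medial = solve-∀ ℚ-ring

removeSum-*ˡ : ∀ μ (c : ℚ) (F : ℕ → List ℕ → ℚ) → c * removeSum μ F ≡ removeSum μ (λ j ν → c * F j ν)
removeSum-*ˡ []      c F = ℚP.*-zeroʳ c
removeSum-*ˡ (k ∷ μ) c F = trans (ℚP.*-distribˡ-+ c _ _) (cong₂ _+_ (swap c (toℚ k) (F k μ)) (removeSum-*ˡ μ c _))
  where
  swap : ∀ a b x → a * (b * x) ≡ b * (a * x)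
  swap = solve-∀ ℚ-ring

removeSum-zero : ∀ μ → removeSum μ (λ _ _ → 0ℚ) ≡ 0ℚ
removeSum-zero []      = refl
removeSum-zero (k ∷ μ) = cong₂ _+_ (ℚP.*-zeroʳ (toℚ k)) (removeSum-zero μ)

removeSum-∑ : ∀ {A : Set} μ (xs : List A) (F : A → ℕ → List ℕ → ℚ) →
  removeSum μ (λ j ν → ∑ xs (λ x → F x j ν)) ≡ ∑ xs (λ x → removeSum μ (F x))
removeSum-∑ μ []       F = removeSum-zero μ
removeSum-∑ μ (x ∷ xs) F = trans (removeSum-+ μ (F x) _) (cong (removeSum μ (F x) +_) (removeSum-∑ μ xs F))

lowerAt-lowerAt-comm : ∀ {N} (β : Vec ℕ N) v w j k (X : Vec ℕ N → ℚ) →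
  [ j ≤? lookup β v ] * ([ k ≤? lookup (lowerAt β v j) w ] * X (lowerAt (lowerAt β v j) w k)) ≡
  [ k ≤? lookup β w ] * ([ j ≤? lookup (lowerAt β w k) v ] * X (lowerAt (lowerAt β w k) v j))
lowerAt-lowerAt-comm β v w j k X with v Fin.≟ w
... | yes refl = begin
  [ j ≤? b ] * ([ k ≤? lookup (lowerAt β v j) v ] * X βjk)
    ≡⟨ cong (λ t → [ j ≤? b ] * ([ k ≤? t ] * X βjk)) (VecP.lookup∘updateAt v β) ⟩
  [ j ≤? b ] * ([ k ≤? b ∸ j ] * X βjk)
    ≡⟨ sym (ℚP.*-assoc [ j ≤? b ] [ k ≤? b ∸ j ] (X βjk)) ⟩
  ([ j ≤? b ] * [ k ≤? b ∸ j ]) * X βjk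
    ≡⟨ cong₂ _*_ (iverson-≤-∸-comm j k b) (cong X lowerAt-twice) ⟩
  ([ k ≤? b ] * [ j ≤? b ∸ k ]) * X βkj
    ≡⟨ ℚP.*-assoc [ k ≤? b ] [ j ≤? b ∸ k ] (X βkj) ⟩
  [ k ≤? b ] * ([ j ≤? b ∸ k ] * X βkj)
    ≡⟨ cong (λ t → [ k ≤? b ] * ([ j ≤? t ] * X βkj)) (sym (VecP.lookup∘updateAt v β)) ⟩
  [ k ≤? b ] * ([ j ≤? lookup (lowerAt β v k) v ] * X βkj) ∎
  where
  open ≡-Reasoning
  b = lookup β v
  βjk = lowerAt (lowerAt β v j) v k
  βkj = lowerAt (lowerAt β v k) v j
  lowerAt-twice : βjk ≡ βkj
  lowerAt-twice = trans (VecP.updateAt-updateAt v β)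
    (trans (VecP.updateAt-cong v (λ x → ∸-comm x j k) β) (sym (VecP.updateAt-updateAt v β)))
... | no v≢w = begin
  [ j ≤? lookup β v ] * ([ k ≤? lookup (lowerAt β v j) w ] * X (lowerAt (lowerAt β v j) w k))
    ≡⟨ cong₂ (λ t u → [ j ≤? lookup β v ] * ([ k ≤? t ] * X u)) (VecP.lookup∘updateAt′ w v w≢v β) (VecP.updateAt-commutes w v w≢v β) ⟩
  [ j ≤? lookup β v ] * ([ k ≤? lookup β w ] * X βkj)
    ≡⟨ swap [ j ≤? lookup β v ] [ k ≤? lookup β w ] (X βkj) ⟩
  [ k ≤? lookup β w ] * ([ j ≤? lookup β v ] * X βkj)
    ≡⟨ cong (λ t → [ k ≤? lookup β w ] * ([ j ≤? t ] * X βkj)) (sym (VecP.lookup∘updateAt′ v w v≢w β)) ⟩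
  [ k ≤? lookup β w ] * ([ j ≤? lookup (lowerAt β w k) v ] * X βkj) ∎
  where
  open ≡-Reasoning
  βkj = lowerAt (lowerAt β w k) v j
  w≢v = λ w≡v → v≢w (sym w≡v)
  swap : ∀ a b x → a * (b * x) ≡ b * (a * x)
  swap = solve-∀ ℚ-ring

toℚ-lookup-lowerAt : ∀ {N} (β : Vec ℕ N) v w k → k ≤ lookup β w →
  toℚ (lookup β v) ≡ toℚ (lookup (lowerAt β w k) v) + [ w Fin.≟ v ] * toℚ k
toℚ-lookup-lowerAt β v w k k≤βw with w Fin.≟ v
... | yes refl = begin
  toℚ (lookup β w)                            ≡⟨ cong toℚ (sym (ℕP.m∸n+n≡m k≤βw)) ⟩
  toℚ (lookup β w ∸ k ℕ.+ k)                  ≡⟨ toℚ-+ (lookup β w ∸ k) k ⟩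
  toℚ (lookup β w ∸ k) + toℚ k                ≡⟨ cong₂ _+_ (cong toℚ (sym (VecP.lookup∘updateAt w β))) (sym (ℚP.*-identityˡ (toℚ k))) ⟩
  toℚ (lookup (lowerAt β w k) w) + 1ℚ * toℚ k ∎
  where open ≡-Reasoning
... | no w≢v = begin
  toℚ (lookup β v)                            ≡⟨ cong toℚ (sym (VecP.lookup∘updateAt′ v w (λ v≡w → w≢v (sym v≡w)) β)) ⟩
  toℚ (lookup (lowerAt β w k) v)              ≡⟨ sym (ℚP.+-identityʳ _) ⟩
  toℚ (lookup (lowerAt β w k) v) + 0ℚ         ≡⟨ cong (toℚ (lookup (lowerAt β w k) v) +_) (sym (ℚP.*-zeroˡ (toℚ k))) ⟩
  toℚ (lookup (lowerAt β w k) v) + 0ℚ * toℚ k ∎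
  where open ≡-Reasoning

toℚ-lookup-guarded : ∀ {N} (β : Vec ℕ N) v w k (x : ℚ) →
  toℚ (lookup β v) * ([ k ≤? lookup β w ] * x) ≡
  [ k ≤? lookup β w ] * (toℚ (lookup (lowerAt β w k) v) * x) + [ w Fin.≟ v ] * (toℚ k * ([ k ≤? lookup β w ] * x))
toℚ-lookup-guarded β v w k x = begin
  toℚ (lookup β v) * ([ k ≤? lookup β w ] * x)
    ≡⟨ swap (toℚ (lookup β v)) [ k ≤? lookup β w ] x ⟩
  [ k ≤? lookup β w ] * (toℚ (lookup β v) * x)
    ≡⟨ iverson-guard (k ≤? lookup β w) (λ k≤βw → cong (_* x) (toℚ-lookup-lowerAt β v w k k≤βw)) ⟩
  [ k ≤? lookup β w ] * ((toℚ (lookup (lowerAt β w k) v) + [ w Fin.≟ v ] * toℚ k) * x)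
    ≡⟨ expand [ k ≤? lookup β w ] (toℚ (lookup (lowerAt β w k) v)) [ w Fin.≟ v ] (toℚ k) x ⟩
  [ k ≤? lookup β w ] * (toℚ (lookup (lowerAt β w k) v) * x) + [ w Fin.≟ v ] * (toℚ k * ([ k ≤? lookup β w ] * x)) ∎
  where
  open ≡-Reasoning
  swap : ∀ a b y → a * (b * y) ≡ b * (a * y)
  swap = solve-∀ ℚ-ring
  expand : ∀ d l δ c y → d * ((l + δ * c) * y) ≡ d * (l * y) + δ * (c * (d * y))
  expand = solve-∀ ℚ-ring

-- The Euler operator x_v ∂/∂x_v acts on p_μ by the Leibniz rule, one part of μ at a time.
euler-pCoeff : ∀ {N} μ (β : Vec ℕ N) v →
  toℚ (lookup β v) * pCoeff μ β ≡ removeSum μ (λ j ν → [ j ≤? lookup β v ] * pCoeff ν (lowerAt β v j))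
euler-pCoeff {N} [] β v with β ≟ᵛ Vec.replicate N 0
... | yes refl = cong (λ a → toℚ a * 1ℚ) (VecP.lookup-replicate v 0)
... | no  _    = ℚP.*-zeroʳ (toℚ (lookup β v))
euler-pCoeff {N} (k ∷ μ) β v = begin
  toℚ (lookup β v) * ∑ (allFin N) (λ w → [ k ≤? lookup β w ] * X w)
    ≡⟨ ∑-*ˡ (toℚ (lookup β v)) (allFin N) _ ⟩
  ∑ (allFin N) (λ w → toℚ (lookup β v) * ([ k ≤? lookup β w ] * X w))
    ≡⟨ ∑-cong (allFin N) (λ w → toℚ-lookup-guarded β v w k (X w)) ⟩
  ∑ (allFin N) (λ w → A w + [ w Fin.≟ v ] * K w)
    ≡⟨ ∑-+ (allFin N) A _ ⟩
  ∑ (allFin N) A + ∑ (allFin N) (λ w → [ w Fin.≟ v ] * K w)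
    ≡⟨ cong (∑ (allFin N) A +_) (∑-allFin-δ N v K) ⟩
  ∑ (allFin N) A + K v
    ≡⟨ ℚP.+-comm (∑ (allFin N) A) (K v) ⟩
  K v + ∑ (allFin N) A
    ≡⟨ cong (K v +_) (sym tail) ⟩
  removeSum (k ∷ μ) (λ j ν → [ j ≤? lookup β v ] * pCoeff ν (lowerAt β v j)) ∎
  where
  open ≡-Reasoning
  X : Fin N → ℚ
  X w = pCoeff μ (lowerAt β w k)
  A K : Fin N → ℚ
  A w = [ k ≤? lookup β w ] * (toℚ (lookup (lowerAt β w k) v) * X w)
  K w = toℚ k * ([ k ≤? lookup β w ] * X w)
  tail : removeSum μ (λ j ν → [ j ≤? lookup β v ] * pCoeff (k ∷ ν) (lowerAt β v j)) ≡ ∑ (allFin N) A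
  tail = begin
    removeSum μ (λ j ν → [ j ≤? lookup β v ] * ∑ (allFin N) (λ w → [ k ≤? lookup (lowerAt β v j) w ] * pCoeff ν (lowerAt (lowerAt β v j) w k)))
      ≡⟨ removeSum-cong μ (λ j ν → trans (∑-*ˡ [ j ≤? lookup β v ] (allFin N) (λ w → [ k ≤? lookup (lowerAt β v j) w ] * pCoeff ν (lowerAt (lowerAt β v j) w k))) (∑-cong (allFin N) (λ w → lowerAt-lowerAt-comm β v w j k (pCoeff ν)))) ⟩
    removeSum μ (λ j ν → ∑ (allFin N) (λ w → [ k ≤? lookup β w ] * ([ j ≤? lookup (lowerAt β w k) v ] * pCoeff ν (lowerAt (lowerAt β w k) v j))))
      ≡⟨ removeSum-∑ μ (allFin N) _ ⟩
    ∑ (allFin N) (λ w → removeSum μ (λ j ν → [ k ≤? lookup β w ] * ([ j ≤? lookup (lowerAt β w k) v ] * pCoeff ν (lowerAt (lowerAt β w k) v j))))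
      ≡⟨ ∑-cong (allFin N) (λ w → sym (removeSum-*ˡ μ [ k ≤? lookup β w ] _)) ⟩
    ∑ (allFin N) (λ w → [ k ≤? lookup β w ] * removeSum μ (λ j ν → [ j ≤? lookup (lowerAt β w k) v ] * pCoeff ν (lowerAt (lowerAt β w k) v j)))
      ≡⟨ ∑-cong (allFin N) (λ w → cong ([ k ≤? lookup β w ] *_) (sym (euler-pCoeff μ (lowerAt β w k) v))) ⟩
    ∑ (allFin N) A ∎

partitions : ℕ → ℕ → List (List ℕ)
partitions k b = parts k k b

private
  concatMap-filter-suc-cong : ∀ {B : Set} {P : ℕ → Set} (P? : Decidable P) (g h : ℕ → List B) xs →
    (∀ i → g (suc i) ≡ h (suc i)) → concatMap g (filter P? (map suc xs)) ≡ concatMap h (filter P? (map suc xs))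
  concatMap-filter-suc-cong P? g h []       g≗h = refl
  concatMap-filter-suc-cong P? g h (x ∷ xs) g≗h with P? (suc x)
  ... | yes _ = cong₂ _++_ (g≗h x) (concatMap-filter-suc-cong P? g h xs g≗h)
  ... | no  _ = concatMap-filter-suc-cong P? g h xs g≗h

parts-fuel : ∀ f f′ k b → k ≤ f → k ≤ f′ → parts f k b ≡ parts f′ k b
parts-fuel f       f′       zero    b _         _          = refl
parts-fuel (suc f) (suc f′) (suc n) b (s≤s n≤f) (s≤s n≤f′) = concatMap-filter-suc-cong (_≤? suc n) _ _ (upTo b)
  (λ i → cong (map (suc i ∷_)) (parts-fuel f f′ (n ∸ i) (suc i) (ℕP.≤-trans (ℕP.m∸n≤m n i) n≤f) (ℕP.≤-trans (ℕP.m∸n≤m n i) n≤f′)))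

∑-parts-suc : ∀ f n b (G : List ℕ → ℚ) → ∑ (parts (suc f) (suc n) b) G ≡
  ∑ (upTo b) (λ i → [ suc i ≤? suc n ] * ∑ (parts f (n ∸ i) (suc i)) (λ ν → G (suc i ∷ ν)))
∑-parts-suc f n b G = begin
  ∑ (concatMap (λ j → map (j ∷_) (parts f (suc n ∸ j) j)) (filter (_≤? suc n) (map suc (upTo b)))) G
    ≡⟨ ∑-concatMap _ (filter (_≤? suc n) (map suc (upTo b))) G ⟩
  ∑ (filter (_≤? suc n) (map suc (upTo b))) (λ j → ∑ (map (j ∷_) (parts f (suc n ∸ j) j)) G)
    ≡⟨ ∑-filter (_≤? suc n) (map suc (upTo b)) _ ⟩
  ∑ (map suc (upTo b)) (λ j → [ j ≤? suc n ] * ∑ (map (j ∷_) (parts f (suc n ∸ j) j)) G)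
    ≡⟨ ∑-map suc (upTo b) _ ⟩
  ∑ (upTo b) (λ i → [ suc i ≤? suc n ] * ∑ (map (suc i ∷_) (parts f (n ∸ i) (suc i))) G)
    ≡⟨ ∑-cong (upTo b) (λ i → cong ([ suc i ≤? suc n ] *_) (∑-map (suc i ∷_) (parts f (n ∸ i) (suc i)) G)) ⟩
  ∑ (upTo b) (λ i → [ suc i ≤? suc n ] * ∑ (parts f (n ∸ i) (suc i)) (λ ν → G (suc i ∷ ν))) ∎
  where open ≡-Reasoning

∑-partitions-split : ∀ k b (G : List ℕ → ℚ) → ∑ (partitions k (suc b)) G ≡
  ∑ (partitions k b) G + [ suc b ≤? k ] * ∑ (partitions (k ∸ suc b) (suc b)) (λ ν → G (suc b ∷ ν))
∑-partitions-split zero    b G = sym (trans (cong (G [] + 0ℚ +_) (ℚP.*-zeroˡ (G (suc b ∷ []) + 0ℚ))) (ℚP.+-identityʳ _))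
∑-partitions-split (suc n) b G = begin
  ∑ (partitions (suc n) (suc b)) G ≡⟨ ∑-parts-suc n n (suc b) G ⟩
  ∑ (upTo (suc b)) T               ≡⟨ ∑-upTo-last b T ⟩
  ∑ (upTo b) T + T b               ≡⟨ cong₂ _+_ (sym (∑-parts-suc n n b G)) (cong (λ ps → [ suc b ≤? suc n ] * ∑ ps (λ ν → G (suc b ∷ ν))) (parts-fuel n (n ∸ b) (n ∸ b) (suc b) (ℕP.m∸n≤m n b) ℕP.≤-refl)) ⟩
  ∑ (partitions (suc n) b) G + [ suc b ≤? suc n ] * ∑ (partitions (n ∸ b) (suc b)) (λ ν → G (suc b ∷ ν)) ∎
  where
  open ≡-Reasoning
  T : ℕ → ℚ
  T i = [ suc i ≤? suc n ] * ∑ (parts n (n ∸ i) (suc i)) (λ ν → G (suc i ∷ ν))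

Descending : ℕ → List ℕ → Set
Descending b []      = ⊤
Descending b (x ∷ μ) = (1 ≤ x × x ≤ b) × Descending x μ

IsPartition : ℕ → ℕ → List ℕ → Set
IsPartition k b μ = sum μ ≡ k × Descending b μ

parts-sound : ∀ f k b → k ≤ f → All (IsPartition k b) (parts f k b)
parts-sound f       zero    b _         = (refl , tt) ∷ []
parts-sound (suc f) (suc n) b (s≤s n≤f) = AllP.concat⁺ (AllP.map⁺ (All.zipWith (λ (r , q) → r q)
  (AllP.filter⁺ (_≤? suc n) (AllP.map⁺ {P = Extends} (AllP.applyUpTo⁺₁ (λ i → i) b extend)) , AllP.all-filter (_≤? suc n) (map suc (upTo b)))))
  where
  Extends : ℕ → Set
  Extends j = j ≤ suc n → All (IsPartition (suc n) b) (map (j ∷_) (parts f (suc n ∸ j) j))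
  extend : ∀ {i} → i < b → suc i ≤ suc n → All (IsPartition (suc n) b) (map (suc i ∷_) (parts f (n ∸ i) (suc i)))
  extend {i} i<b i<sn = AllP.map⁺ (All.map (λ (sum≡ , desc) → trans (cong (suc i ℕ.+_) sum≡) (ℕP.m+[n∸m]≡n i<sn) , (s≤s z≤n , i<b) , desc)
    (parts-sound f (n ∸ i) (suc i) (ℕP.≤-trans (ℕP.m∸n≤m n i) n≤f)))

partitions-sound : ∀ k b → All (IsPartition k b) (partitions k b)
partitions-sound k b = parts-sound k k b ℕP.≤-refl

∑-partitions-by-largest : ∀ b (G : List ℕ → ℚ) M k → k ≤ M → ∑ (partitions k (suc b)) G ≡
  ∑ (upTo (suc M)) (λ m → [ m ℕ.* suc b ≤? k ] * ∑ (partitions (k ∸ m ℕ.* suc b) b) (λ ν → G (replicate m (suc b) ++ ν)))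
∑-partitions-by-largest b G zero    .zero z≤n = sym (trans (ℚP.+-identityʳ _) (ℚP.*-identityˡ _))
∑-partitions-by-largest b G (suc M) k k≤M = begin
  ∑ (partitions k (suc b)) G
    ≡⟨ ∑-partitions-split k b G ⟩
  ∑ (partitions k b) G + [ suc b ≤? k ] * ∑ (partitions (k ∸ suc b) (suc b)) (λ ν → G (suc b ∷ ν))
    ≡⟨ cong₂ _+_ (sym (ℚP.*-identityˡ (∑ (partitions k b) G))) (cong ([ suc b ≤? k ] *_) (∑-partitions-by-largest b (λ ν → G (suc b ∷ ν)) M (k ∸ suc b) k∸b≤M)) ⟩
  f 0 + [ suc b ≤? k ] * ∑ (upTo (suc M)) (λ m → [ m ℕ.* suc b ≤? k ∸ suc b ] * Y m)
    ≡⟨ cong (f 0 +_) (trans (∑-*ˡ [ suc b ≤? k ] (upTo (suc M)) (λ m → [ m ℕ.* suc b ≤? k ∸ suc b ] * Y m)) (∑-cong (upTo (suc M)) shift)) ⟩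
  f 0 + ∑ (upTo (suc M)) (λ m → f (suc m))
    ≡⟨ sym (∑-upTo-suc (suc M) f) ⟩
  ∑ (upTo (suc (suc M))) f ∎
  where
  open ≡-Reasoning
  f : ℕ → ℚ
  f m = [ m ℕ.* suc b ≤? k ] * ∑ (partitions (k ∸ m ℕ.* suc b) b) (λ ν → G (replicate m (suc b) ++ ν))
  Y : ℕ → ℚ
  Y m = ∑ (partitions (k ∸ suc b ∸ m ℕ.* suc b) b) (λ ν → G (suc b ∷ replicate m (suc b) ++ ν))
  k∸b≤M : k ∸ suc b ≤ M
  k∸b≤M = ℕP.≤-trans (ℕP.∸-monoʳ-≤ k (s≤s z≤n)) (ℕP.∸-monoˡ-≤ 1 k≤M)
  shift : ∀ m → [ suc b ≤? k ] * ([ m ℕ.* suc b ≤? k ∸ suc b ] * Y m) ≡ f (suc m)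
  shift m = begin
    [ suc b ≤? k ] * ([ m ℕ.* suc b ≤? k ∸ suc b ] * Y m)   ≡⟨ sym (ℚP.*-assoc [ suc b ≤? k ] [ m ℕ.* suc b ≤? k ∸ suc b ] (Y m)) ⟩
    [ suc b ≤? k ] * [ m ℕ.* suc b ≤? k ∸ suc b ] * Y m     ≡⟨ cong (_* Y m) (iverson-≤-∸ (suc b) (m ℕ.* suc b) k) ⟩
    [ m ℕ.* suc b ℕ.+ suc b ≤? k ] * Y m                    ≡⟨ cong₂ (λ t u → [ t ≤? k ] * ∑ (partitions u b) (λ ν → G (replicate (suc m) (suc b) ++ ν)))
                                                                     (ℕP.+-comm (m ℕ.* suc b) (suc b)) (ℕP.∸-+-assoc k (suc b) (m ℕ.* suc b)) ⟩
    f (suc m)                                               ∎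

descending-bounded : ∀ b ν → Descending b ν → All (λ x → 1 ≤ x × x ≤ b) ν
descending-bounded b []      _                  = []
descending-bounded b (x ∷ ν) ((1≤x , x≤b) , ν↓) =
  (1≤x , x≤b) ∷ All.map (λ (1≤y , y≤x) → 1≤y , ℕP.≤-trans y≤x x≤b) (descending-bounded x ν ν↓)

mult-head : ∀ j λs → mult j (j ∷ λs) ≡ suc (mult j λs)
mult-head j λs = cong length (ListP.filter-accept (_≟ j) refl)

mult-head≢ : ∀ j x λs → x ≢ j → mult j (x ∷ λs) ≡ mult j λs
mult-head≢ j x λs x≢j = cong length (ListP.filter-reject (_≟ j) x≢j)

mult-beyond-size : ∀ j λs → size λs < j → mult j λs ≡ 0
mult-beyond-size j []       _ = refl
mult-beyond-size j (x ∷ λs) x+s<j = trans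
  (mult-head≢ j x λs (λ x≡j → ℕP.<-irrefl x≡j (ℕP.≤-<-trans (ℕP.m≤m+n x (size λs)) x+s<j)))
  (mult-beyond-size j λs (ℕP.≤-<-trans (ℕP.m≤n+m (size λs) x) x+s<j))

zFactor : List ℕ → ℕ → ℕ
zFactor λs j = mult j λs ! ℕ.* j ^ mult j λs

∏< : ℕ → (ℕ → ℕ) → ℕ
∏< zero    h = 1
∏< (suc M) h = h 0 ℕ.* ∏< M (h ∘ suc)

∏<-last : ∀ M h → ∏< (suc M) h ≡ ∏< M h ℕ.* h M
∏<-last zero    h = trans (ℕP.*-identityʳ (h 0)) (sym (ℕP.*-identityˡ (h 0)))
∏<-last (suc M) h = trans (cong (h 0 ℕ.*_) (∏<-last M (h ∘ suc))) (sym (ℕP.*-assoc (h 0) _ _))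

∏<-cong : ∀ M {h h′ : ℕ → ℕ} → (∀ {i} → i < M → h i ≡ h′ i) → ∏< M h ≡ ∏< M h′
∏<-cong zero    h≗h′ = refl
∏<-cong (suc M) h≗h′ = cong₂ ℕ._*_ (h≗h′ (s≤s z≤n)) (∏<-cong M (λ i<M → h≗h′ (s≤s i<M)))

product-map-applyUpTo : ∀ (h f : ℕ → ℕ) M → product (map h (applyUpTo f M)) ≡ ∏< M (h ∘ f)
product-map-applyUpTo h f zero    = refl
product-map-applyUpTo h f (suc M) = cong (h (f 0) ℕ.*_) (product-map-applyUpTo h (f ∘ suc) M)

z≡∏< : ∀ λs → z λs ≡ ∏< (size λs) (zFactor λs ∘ suc)
z≡∏< λs = trans (cong product (sym (ListP.map-∘ (upTo (size λs))))) (product-map-applyUpTo (zFactor λs ∘ suc) id (size λs))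

∏<-zFactor-beyond : ∀ λs M → size λs ≤ M → ∏< M (zFactor λs ∘ suc) ≡ z λs
∏<-zFactor-beyond λs M s≤M = trans (cong (λ t → ∏< t (zFactor λs ∘ suc)) (sym (ℕP.m+[n∸m]≡n s≤M))) (extend (M ∸ size λs))
  where
  extend : ∀ d → ∏< (size λs ℕ.+ d) (zFactor λs ∘ suc) ≡ z λs
  extend zero    = trans (cong (λ t → ∏< t (zFactor λs ∘ suc)) (ℕP.+-identityʳ (size λs))) (sym (z≡∏< λs))
  extend (suc d) = begin
    ∏< (size λs ℕ.+ suc d) (zFactor λs ∘ suc)                          ≡⟨ cong (λ t → ∏< t (zFactor λs ∘ suc)) (ℕP.+-suc (size λs) d) ⟩
    ∏< (suc (size λs ℕ.+ d)) (zFactor λs ∘ suc)                        ≡⟨ ∏<-last (size λs ℕ.+ d) (zFactor λs ∘ suc) ⟩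
    ∏< (size λs ℕ.+ d) (zFactor λs ∘ suc) ℕ.* zFactor λs (suc (size λs ℕ.+ d)) ≡⟨ cong (λ m → ∏< (size λs ℕ.+ d) (zFactor λs ∘ suc) ℕ.* (m ! ℕ.* suc (size λs ℕ.+ d) ^ m))
                                                                          (mult-beyond-size (suc (size λs ℕ.+ d)) λs (s≤s (ℕP.m≤m+n (size λs) d))) ⟩
    ∏< (size λs ℕ.+ d) (zFactor λs ∘ suc) ℕ.* 1                          ≡⟨ ℕP.*-identityʳ _ ⟩
    ∏< (size λs ℕ.+ d) (zFactor λs ∘ suc)                              ≡⟨ extend d ⟩
    z λs                                                             ∎
    where open ≡-Reasoning

∏<-zFactor-∷ : ∀ k μ M → 1 ≤ k → k ≤ M → ∏< M (zFactor (k ∷ μ) ∘ suc) ≡ ∏< M (zFactor μ ∘ suc) ℕ.* (k ℕ.* suc (mult k μ))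
∏<-zFactor-∷ k μ zero    1≤k k≤0 = ⊥-elim (ℕP.<-irrefl refl (ℕP.≤-trans 1≤k k≤0))
∏<-zFactor-∷ k μ (suc M) 1≤k k≤M with k ≟ suc M
... | yes refl = begin
  ∏< (suc M) (zFactor (k ∷ μ) ∘ suc)                 ≡⟨ ∏<-last M (zFactor (k ∷ μ) ∘ suc) ⟩
  ∏< M (zFactor (k ∷ μ) ∘ suc) ℕ.* zFactor (k ∷ μ) k   ≡⟨ cong₂ ℕ._*_ (∏<-cong M (λ {i} i<M → cong (λ t → t ! ℕ.* suc i ^ t) (mult-head≢ (suc i) k μ (λ k≡ → ℕP.<-irrefl (sym k≡) (s≤s i<M)))))
                                                                 (cong (λ t → t ! ℕ.* k ^ t) (mult-head k μ)) ⟩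
  ∏< M (zFactor μ ∘ suc) ℕ.* (suc r ! ℕ.* k ^ suc r)      ≡⟨ regroup (∏< M (zFactor μ ∘ suc)) (r !) k (k ^ r) r ⟩
  (∏< M (zFactor μ ∘ suc) ℕ.* zFactor μ k) ℕ.* (k ℕ.* suc r) ≡⟨ cong (ℕ._* (k ℕ.* suc r)) (sym (∏<-last M (zFactor μ ∘ suc))) ⟩
  ∏< (suc M) (zFactor μ ∘ suc) ℕ.* (k ℕ.* suc r)          ∎
  where
  open ≡-Reasoning
  r = mult k μ
  regroup : ∀ a f k′ q m′ → a ℕ.* ((suc m′ ℕ.* f) ℕ.* (k′ ℕ.* q)) ≡ (a ℕ.* (f ℕ.* q)) ℕ.* (k′ ℕ.* suc m′)
  regroup = ℕ-Solver.solve-∀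
... | no k≢ = begin
  ∏< (suc M) (zFactor (k ∷ μ) ∘ suc)                     ≡⟨ ∏<-last M (zFactor (k ∷ μ) ∘ suc) ⟩
  ∏< M (zFactor (k ∷ μ) ∘ suc) ℕ.* zFactor (k ∷ μ) (suc M) ≡⟨ cong₂ ℕ._*_ (∏<-zFactor-∷ k μ M 1≤k (ℕ.s≤s⁻¹ (ℕP.≤∧≢⇒< k≤M k≢)))
                                                                     (cong (λ t → t ! ℕ.* suc M ^ t) (mult-head≢ (suc M) k μ k≢)) ⟩
  (∏< M (zFactor μ ∘ suc) ℕ.* c) ℕ.* zFactor μ (suc M)        ≡⟨ swap (∏< M (zFactor μ ∘ suc)) c (zFactor μ (suc M)) ⟩
  (∏< M (zFactor μ ∘ suc) ℕ.* zFactor μ (suc M)) ℕ.* c        ≡⟨ cong (ℕ._* c) (sym (∏<-last M (zFactor μ ∘ suc))) ⟩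
  ∏< (suc M) (zFactor μ ∘ suc) ℕ.* c                        ∎
  where
  open ≡-Reasoning
  c = k ℕ.* suc (mult k μ)
  swap : ∀ a b x → (a ℕ.* b) ℕ.* x ≡ (a ℕ.* x) ℕ.* b
  swap = ℕ-Solver.solve-∀

z-∷ : ∀ k μ → 1 ≤ k → z (k ∷ μ) ≡ z μ ℕ.* (k ℕ.* suc (mult k μ))
z-∷ k μ 1≤k = begin
  z (k ∷ μ)                                      ≡⟨ z≡∏< (k ∷ μ) ⟩
  ∏< (k ℕ.+ size μ) (zFactor (k ∷ μ) ∘ suc)        ≡⟨ ∏<-zFactor-∷ k μ (k ℕ.+ size μ) 1≤k (ℕP.m≤m+n k (size μ)) ⟩
  ∏< (k ℕ.+ size μ) (zFactor μ ∘ suc) ℕ.* (k ℕ.* suc (mult k μ)) ≡⟨ cong (ℕ._* (k ℕ.* suc (mult k μ))) (∏<-zFactor-beyond μ (k ℕ.+ size μ) (ℕP.m≤n+m (size μ) k)) ⟩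
  z μ ℕ.* (k ℕ.* suc (mult k μ))                     ∎
  where open ≡-Reasoning

mult-absent : ∀ j ν → All (_≢ j) ν → mult j ν ≡ 0
mult-absent j []      _            = refl
mult-absent j (x ∷ ν) (x≢j ∷ ν≢j) = trans (mult-head≢ j x ν x≢j) (mult-absent j ν ν≢j)

Positive : List ℕ → Set
Positive = All (1 ≤_)

z-pos : ∀ μ → Positive μ → 1 ≤ z μ
z-pos []      _          = s≤s z≤n
z-pos (k ∷ μ) (1≤k ∷ μ⁺) = subst (1 ≤_) (sym (z-∷ k μ 1≤k)) (ℕP.*-mono-≤ (z-pos μ μ⁺) (ℕP.*-mono-≤ 1≤k (s≤s z≤n)))

mult-replicate-++ : ∀ b m ν → mult b ν ≡ 0 → mult b (replicate m b ++ ν) ≡ m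
mult-replicate-++ b zero    ν b∉ν = b∉ν
mult-replicate-++ b (suc m) ν b∉ν = trans (mult-head b (replicate m b ++ ν)) (cong suc (mult-replicate-++ b m ν b∉ν))

positive-replicate-++ : ∀ b m ν → 1 ≤ b → Positive ν → Positive (replicate m b ++ ν)
positive-replicate-++ b zero    ν 1≤b ν⁺ = ν⁺
positive-replicate-++ b (suc m) ν 1≤b ν⁺ = 1≤b ∷ positive-replicate-++ b m ν 1≤b ν⁺

module Weighted (c : ℕ → ℚ) where

  cProd : List ℕ → ℚ
  cProd []      = 1ℚ
  cProd (x ∷ μ) = c x * cProd μ

  weight : List ℕ → ℚ
  weight μ = cProd μ * inv (z μ)

  weight-∷ : ∀ k μ → 1 ≤ k → Positive μ → weight (k ∷ μ) ≡ (c k * inv k * inv (suc (mult k μ))) * weight μ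
  weight-∷ k μ 1≤k μ⁺ = begin
    (c k * cProd μ) * inv (z (k ∷ μ))                        ≡⟨ cong (λ t → (c k * cProd μ) * inv t) (z-∷ k μ 1≤k) ⟩
    (c k * cProd μ) * inv (z μ ℕ.* (k ℕ.* suc r))            ≡⟨ cong ((c k * cProd μ) *_) (inv-* (z μ) (k ℕ.* suc r) (z-pos μ μ⁺) (ℕP.*-mono-≤ 1≤k (s≤s z≤n))) ⟩
    (c k * cProd μ) * (inv (z μ) * inv (k ℕ.* suc r))        ≡⟨ cong (λ t → (c k * cProd μ) * (inv (z μ) * t)) (inv-* k (suc r) 1≤k (s≤s z≤n)) ⟩
    (c k * cProd μ) * (inv (z μ) * (inv k * inv (suc r)))    ≡⟨ regroup (c k) (cProd μ) (inv (z μ)) (inv k) (inv (suc r)) ⟩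
    (c k * inv k * inv (suc r)) * (cProd μ * inv (z μ))      ∎
    where
    open ≡-Reasoning
    r = mult k μ
    regroup : ∀ a w iz ik ir → (a * w) * (iz * (ik * ir)) ≡ (a * ik * ir) * (w * iz)
    regroup = solve-∀ ℚ-ring

  -- The weight c(b)^m / (b^m m!) of a block of m parts equal to b.
  blockWeight : ℕ → ℕ → ℚ
  blockWeight b zero    = 1ℚ
  blockWeight b (suc m) = (c b * inv b * inv (suc m)) * blockWeight b m

  weight-replicate-++ : ∀ b m ν → 1 ≤ b → mult b ν ≡ 0 → Positive ν → weight (replicate m b ++ ν) ≡ blockWeight b m * weight ν
  weight-replicate-++ b zero    ν _   _    _  = sym (ℚP.*-identityˡ (weight ν))
  weight-replicate-++ b (suc m) ν 1≤b b∉ν ν⁺ = begin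
    weight (b ∷ replicate m b ++ ν)                                             ≡⟨ weight-∷ b (replicate m b ++ ν) 1≤b (positive-replicate-++ b m ν 1≤b ν⁺) ⟩
    (c b * inv b * inv (suc (mult b (replicate m b ++ ν)))) * weight (replicate m b ++ ν)
      ≡⟨ cong₂ (λ t u → (c b * inv b * inv (suc t)) * u) (mult-replicate-++ b m ν b∉ν) (weight-replicate-++ b m ν 1≤b b∉ν ν⁺) ⟩
    (c b * inv b * inv (suc m)) * (blockWeight b m * weight ν)                  ≡⟨ sym (ℚP.*-assoc (c b * inv b * inv (suc m)) (blockWeight b m) (weight ν)) ⟩
    blockWeight b (suc m) * weight ν                                            ∎
    where open ≡-Reasoning

  blockWeight-suc : ∀ b m → 1 ≤ b → blockWeight b (suc m) * toℚ (suc m ℕ.* b) ≡ c b * blockWeight b m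
  blockWeight-suc (suc b) m _ = begin
    ((c (suc b) * inv (suc b) * inv (suc m)) * κ) * toℚ (suc m ℕ.* suc b)                      ≡⟨ cong (((c (suc b) * inv (suc b) * inv (suc m)) * κ) *_) (toℚ-* (suc m) (suc b)) ⟩
    ((c (suc b) * inv (suc b) * inv (suc m)) * κ) * (toℚ (suc m) * toℚ (suc b))                ≡⟨ regroup (c (suc b)) (inv (suc b)) (inv (suc m)) κ (toℚ (suc m)) (toℚ (suc b)) ⟩
    (c (suc b) * κ) * ((toℚ (suc b) * inv (suc b)) * (toℚ (suc m) * inv (suc m)))              ≡⟨ cong (λ t → (c (suc b) * κ) * t) (cong₂ _*_ (toℚ-inverse b) (toℚ-inverse m)) ⟩
    (c (suc b) * κ) * (1ℚ * 1ℚ)                                                                ≡⟨ ℚP.*-identityʳ (c (suc b) * κ) ⟩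
    c (suc b) * κ                                                                              ∎
    where
    open ≡-Reasoning
    κ = blockWeight (suc b) m
    regroup : ∀ cb ib im k tm tb → ((cb * ib * im) * k) * (tm * tb) ≡ (cb * k) * ((tb * ib) * (tm * im))
    regroup = solve-∀ ℚ-ring

  removeSum-replicate-++ : ∀ m b ν (F : ℕ → List ℕ → ℚ) → removeSum (replicate m b ++ ν) F ≡
    toℚ (m ℕ.* b) * F b (replicate (ℕ.pred m) b ++ ν) + removeSum ν (λ j ν′ → F j (replicate m b ++ ν′))
  removeSum-replicate-++ zero    b ν F = sym (trans (cong (_+ removeSum ν F) (ℚP.*-zeroˡ (F b ν))) (ℚP.+-identityˡ _))
  removeSum-replicate-++ (suc m) b ν F = begin
    toℚ b * X + removeSum (replicate m b ++ ν) (λ j ν′ → F j (b ∷ ν′))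
      ≡⟨ cong (toℚ b * X +_) (removeSum-replicate-++ m b ν (λ j ν′ → F j (b ∷ ν′))) ⟩
    toℚ b * X + (toℚ (m ℕ.* b) * F b (b ∷ replicate (ℕ.pred m) b ++ ν) + R)
      ≡⟨ cong (λ t → toℚ b * X + (t + R)) (shift m) ⟩
    toℚ b * X + (toℚ (m ℕ.* b) * X + R)
      ≡⟨ sym (ℚP.+-assoc (toℚ b * X) (toℚ (m ℕ.* b) * X) R) ⟩
    (toℚ b * X + toℚ (m ℕ.* b) * X) + R
      ≡⟨ cong (_+ R) (trans (sym (ℚP.*-distribʳ-+ X (toℚ b) (toℚ (m ℕ.* b)))) (cong (_* X) (sym (toℚ-+ b (m ℕ.* b))))) ⟩
    toℚ (suc m ℕ.* b) * X + R ∎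
    where
    open ≡-Reasoning
    X = F b (replicate m b ++ ν)
    R = removeSum ν (λ j ν′ → F j (b ∷ replicate m b ++ ν′))
    shift : ∀ m′ → toℚ (m′ ℕ.* b) * F b (b ∷ replicate (ℕ.pred m′) b ++ ν) ≡ toℚ (m′ ℕ.* b) * F b (replicate m′ b ++ ν)
    shift zero     = trans (ℚP.*-zeroˡ (F b (b ∷ ν))) (sym (ℚP.*-zeroˡ (F b ν)))
    shift (suc m′) = refl

  weight-replicate-++-descending : ∀ b m ν → Descending b ν → weight (replicate m (suc b) ++ ν) ≡ blockWeight (suc b) m * weight ν
  weight-replicate-++-descending b m ν ν↓ = weight-replicate-++ (suc b) m ν (s≤s z≤n)
    (mult-absent (suc b) ν (All.map (λ (_ , x≤b) x≡ → ℕP.<-irrefl x≡ (s≤s x≤b)) bounded)) (All.map proj₁ bounded)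
    where bounded = descending-bounded b ν ν↓

  ∑-weight-by-largest : ∀ b (H : List ℕ → ℚ) M k → k ≤ M →
    ∑ (partitions k (suc b)) (λ μ → weight μ * H μ) ≡
    ∑ (upTo (suc M)) (λ m → [ m ℕ.* suc b ≤? k ] * (blockWeight (suc b) m * ∑ (partitions (k ∸ m ℕ.* suc b) b) (λ ν → weight ν * H (replicate m (suc b) ++ ν))))
  ∑-weight-by-largest b H M k k≤M = trans (∑-partitions-by-largest b (λ μ → weight μ * H μ) M k k≤M)
    (∑-cong (upTo (suc M)) (λ m → cong ([ m ℕ.* suc b ≤? k ] *_) (trans
      (∑-cong-All (All.map (λ {ν} (_ , ν↓) → trans (cong (_* H (replicate m (suc b) ++ ν)) (weight-replicate-++-descending b m ν ν↓))
                                                  (ℚP.*-assoc (blockWeight (suc b) m) (weight ν) (H (replicate m (suc b) ++ ν))))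
                           (partitions-sound (k ∸ m ℕ.* suc b) b)))
      (sym (∑-*ˡ (blockWeight (suc b) m) (partitions (k ∸ m ℕ.* suc b) b) (λ ν → weight ν * H (replicate m (suc b) ++ ν)))))))

  removed : ℕ → ℕ → (ℕ → List ℕ → ℚ) → ℕ → ℚ
  removed b k F j = [ j ≤? k ] * (c j * ∑ (partitions (k ∸ j) b) (λ ν → weight ν * F j ν))

  module _ (b : ℕ) (k : ℕ) (F : ℕ → List ℕ → ℚ) where

    private
      B = suc b
      guard : ℕ → ℚ
      guard m = [ m ℕ.* B ≤? k ]
      κ : ℕ → ℚ
      κ = blockWeight B
      rest : ℕ → List (List ℕ)
      rest m = partitions (k ∸ m ℕ.* B) b

    removed-largest : ∑ (upTo (suc k)) (λ m → guard m * (κ m * (toℚ (m ℕ.* B) * ∑ (rest m) (λ ν → weight ν * F B (replicate (ℕ.pred m) B ++ ν)))))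
                      ≡ removed B k F B
    removed-largest = begin
      ∑ (upTo (suc k)) (λ m → guard m * (κ m * (toℚ (m ℕ.* B) * S m)))
        ≡⟨ ∑-upTo-suc k (λ m → guard m * (κ m * (toℚ (m ℕ.* B) * S m))) ⟩
      guard 0 * (1ℚ * (0ℚ * S 0)) + ∑ (upTo k) (λ m → guard (suc m) * (κ (suc m) * (toℚ (suc m ℕ.* B) * S (suc m))))
        ≡⟨ cong₂ _+_ (vanish (guard 0) (S 0)) (∑-cong (upTo k) (λ m → cong (guard (suc m) *_)
             (trans (sym (ℚP.*-assoc (κ (suc m)) (toℚ (suc m ℕ.* B)) (S (suc m)))) (cong (_* S (suc m)) (blockWeight-suc B m (s≤s z≤n)))))) ⟩
      0ℚ + ∑ (upTo k) (λ m → guard (suc m) * ((c B * κ m) * S (suc m)))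
        ≡⟨ ℚP.+-identityˡ _ ⟩
      ∑ (upTo k) (λ m → guard (suc m) * ((c B * κ m) * S (suc m)))
        ≡⟨ regroup-by-largest k refl ⟩
      removed B k F B ∎
      where
      open ≡-Reasoning
      S : ℕ → ℚ
      S m = ∑ (rest m) (λ ν → weight ν * F B (replicate (ℕ.pred m) B ++ ν))
      vanish : ∀ g s → g * (1ℚ * (0ℚ * s)) ≡ 0ℚ
      vanish = solve-∀ ℚ-ring
      regroup : ∀ g₁ g₂ cb κ′ s → (g₁ * g₂) * ((cb * κ′) * s) ≡ g₁ * (cb * (g₂ * (κ′ * s)))
      regroup = solve-∀ ℚ-ring
      regroup-by-largest : ∀ k′ → k′ ≡ k → ∑ (upTo k′) (λ m → guard (suc m) * ((c B * κ m) * S (suc m))) ≡ removed B k F B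
      regroup-by-largest zero     refl = sym (ℚP.*-zeroˡ (c B * ∑ (partitions 0 B) (λ ν → weight ν * F B ν)))
      regroup-by-largest (suc k′) refl = sym (begin
        [ B ≤? k ] * (c B * ∑ (partitions (k ∸ B) B) (λ μ → weight μ * F B μ))
          ≡⟨ cong (λ t → [ B ≤? k ] * (c B * t)) (∑-weight-by-largest b (F B) k′ (k ∸ B) (ℕP.m∸n≤m k′ b)) ⟩
        [ B ≤? k ] * (c B * ∑ (upTo k) (λ m → [ m ℕ.* B ≤? k ∸ B ] * (κ m * Z m)))
          ≡⟨ trans (cong ([ B ≤? k ] *_) (∑-*ˡ (c B) (upTo k) _)) (∑-*ˡ [ B ≤? k ] (upTo k) _) ⟩
        ∑ (upTo k) (λ m → [ B ≤? k ] * (c B * ([ m ℕ.* B ≤? k ∸ B ] * (κ m * Z m))))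
          ≡⟨ ∑-cong (upTo k) (λ m → sym (trans
               (cong (λ t → guard (suc m) * ((c B * κ m) * ∑ (partitions t b) (λ ν → weight ν * F B (replicate m B ++ ν)))) (sym (ℕP.∸-+-assoc k B (m ℕ.* B))))
               (trans (cong (_* ((c B * κ m) * Z m)) (sym (trans (iverson-≤-∸ B (m ℕ.* B) k) (cong (λ t → [ t ≤? k ]) (ℕP.+-comm (m ℕ.* B) B)))))
                      (regroup [ B ≤? k ] [ m ℕ.* B ≤? k ∸ B ] (c B) (κ m) (Z m))))) ⟩
        ∑ (upTo k) (λ m → guard (suc m) * ((c B * κ m) * S (suc m))) ∎)
        where
        Z : ℕ → ℚ
        Z m = ∑ (partitions (k ∸ B ∸ m ℕ.* B) b) (λ ν → weight ν * F B (replicate m B ++ ν))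

    removed-smaller : (∀ k′ F′ → ∑ (partitions k′ b) (λ μ → weight μ * removeSum μ F′) ≡ ∑ (upTo b) (removed b k′ F′ ∘ suc)) →
      ∑ (upTo (suc k)) (λ m → guard m * (κ m * ∑ (rest m) (λ ν → weight ν * removeSum ν (λ j ν′ → F j (replicate m B ++ ν′)))))
      ≡ ∑ (upTo b) (removed B k F ∘ suc)
    removed-smaller ih = begin
      ∑ (upTo (suc k)) (λ m → guard m * (κ m * ∑ (rest m) (λ ν → weight ν * removeSum ν (Fₘ m))))
        ≡⟨ ∑-cong (upTo (suc k)) (λ m → cong (λ t → guard m * (κ m * t)) (ih (k ∸ m ℕ.* B) (Fₘ m))) ⟩
      ∑ (upTo (suc k)) (λ m → guard m * (κ m * ∑ (upTo b) (removed b (k ∸ m ℕ.* B) (Fₘ m) ∘ suc)))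
        ≡⟨ ∑-cong (upTo (suc k)) (λ m → trans (cong (guard m *_) (∑-*ˡ (κ m) (upTo b) _)) (∑-*ˡ (guard m) (upTo b) _)) ⟩
      ∑ (upTo (suc k)) (λ m → ∑ (upTo b) (λ i → guard m * (κ m * removed b (k ∸ m ℕ.* B) (Fₘ m) (suc i))))
        ≡⟨ ∑-comm (upTo (suc k)) (upTo b) _ ⟩
      ∑ (upTo b) (λ i → ∑ (upTo (suc k)) (λ m → guard m * (κ m * removed b (k ∸ m ℕ.* B) (Fₘ m) (suc i))))
        ≡⟨ ∑-cong (upTo b) (λ i → sym (by-largest i)) ⟩
      ∑ (upTo b) (removed B k F ∘ suc) ∎
      where
      open ≡-Reasoning
      Fₘ : ℕ → ℕ → List ℕ → ℚ
      Fₘ m j ν′ = F j (replicate m B ++ ν′)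
      Y : ℕ → ℕ → ℚ
      Y i m = ∑ (partitions (k ∸ suc i ∸ m ℕ.* B) b) (λ ν → weight ν * F (suc i) (replicate m B ++ ν))
      regroup : ∀ g₁ g₂ g₃ g₄ κ′ c′ y → g₁ * g₂ ≡ g₃ * g₄ → g₁ * (κ′ * (g₂ * (c′ * y))) ≡ g₃ * (c′ * (g₄ * (κ′ * y)))
      regroup g₁ g₂ g₃ g₄ κ′ c′ y g₁g₂≡g₃g₄ = begin
        g₁ * (κ′ * (g₂ * (c′ * y))) ≡⟨ pull g₁ g₂ κ′ c′ y ⟩
        (g₁ * g₂) * (κ′ * (c′ * y)) ≡⟨ cong (_* (κ′ * (c′ * y))) g₁g₂≡g₃g₄ ⟩
        (g₃ * g₄) * (κ′ * (c′ * y)) ≡⟨ push g₃ g₄ κ′ c′ y ⟩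
        g₃ * (c′ * (g₄ * (κ′ * y))) ∎
        where
        pull : ∀ a b x y z → a * (x * (b * (y * z))) ≡ (a * b) * (x * (y * z))
        pull = solve-∀ ℚ-ring
        push : ∀ a b x y z → (a * b) * (x * (y * z)) ≡ a * (y * (b * (x * z)))
        push = solve-∀ ℚ-ring
      by-largest : ∀ i → removed B k F (suc i) ≡ ∑ (upTo (suc k)) (λ m → guard m * (κ m * removed b (k ∸ m ℕ.* B) (Fₘ m) (suc i)))
      by-largest i = begin
        [ suc i ≤? k ] * (c (suc i) * ∑ (partitions (k ∸ suc i) B) (λ μ → weight μ * F (suc i) μ))
          ≡⟨ cong (λ t → [ suc i ≤? k ] * (c (suc i) * t)) (∑-weight-by-largest b (F (suc i)) k (k ∸ suc i) (ℕP.m∸n≤m k (suc i))) ⟩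
        [ suc i ≤? k ] * (c (suc i) * ∑ (upTo (suc k)) (λ m → [ m ℕ.* B ≤? k ∸ suc i ] * (κ m * Y i m)))
          ≡⟨ trans (cong ([ suc i ≤? k ] *_) (∑-*ˡ (c (suc i)) (upTo (suc k)) _)) (∑-*ˡ [ suc i ≤? k ] (upTo (suc k)) _) ⟩
        ∑ (upTo (suc k)) (λ m → [ suc i ≤? k ] * (c (suc i) * ([ m ℕ.* B ≤? k ∸ suc i ] * (κ m * Y i m))))
          ≡⟨ ∑-cong (upTo (suc k)) (λ m → sym (trans
               (cong (λ t → guard m * (κ m * ([ suc i ≤? k ∸ m ℕ.* B ] * (c (suc i) * ∑ (partitions t b) (λ ν → weight ν * F (suc i) (replicate m B ++ ν))))))
                     (∸-comm k (m ℕ.* B) (suc i)))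
               (regroup (guard m) [ suc i ≤? k ∸ m ℕ.* B ] [ suc i ≤? k ] [ m ℕ.* B ≤? k ∸ suc i ] (κ m) (c (suc i)) (Y i m)
                        (iverson-≤-∸-comm (m ℕ.* B) (suc i) k)))) ⟩
        ∑ (upTo (suc k)) (λ m → guard m * (κ m * removed b (k ∸ m ℕ.* B) (Fₘ m) (suc i))) ∎

  -- A part j of multiplicity r contributes j·r·W(μ) = c(j)·W(μ without one j): the factor j·r cancels against z.
  ∑-weight-removeSum : ∀ b k (F : ℕ → List ℕ → ℚ) →
    ∑ (partitions k b) (λ μ → weight μ * removeSum μ F) ≡ ∑ (upTo b) (removed b k F ∘ suc)
  ∑-weight-removeSum zero    zero    F = trans (ℚP.+-identityʳ (weight [] * 0ℚ)) (ℚP.*-zeroʳ (weight []))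
  ∑-weight-removeSum zero    (suc k) F = refl
  ∑-weight-removeSum (suc b) k       F = begin
    ∑ (partitions k B) (λ μ → weight μ * removeSum μ F)
      ≡⟨ ∑-weight-by-largest b (λ μ → removeSum μ F) k k ℕP.≤-refl ⟩
    ∑ (upTo (suc k)) (λ m → guard m * (κ m * ∑ (rest m) (λ ν → weight ν * removeSum (replicate m B ++ ν) F)))
      ≡⟨ ∑-cong (upTo (suc k)) (λ m → trans (cong (λ t → guard m * (κ m * t)) (split m)) (distrib (guard m) (κ m) (toℚ (m ℕ.* B) * S₁ m) (S₂ m))) ⟩
    ∑ (upTo (suc k)) (λ m → guard m * (κ m * (toℚ (m ℕ.* B) * S₁ m)) + guard m * (κ m * S₂ m))
      ≡⟨ ∑-+ (upTo (suc k)) (λ m → guard m * (κ m * (toℚ (m ℕ.* B) * S₁ m))) (λ m → guard m * (κ m * S₂ m)) ⟩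
    ∑ (upTo (suc k)) (λ m → guard m * (κ m * (toℚ (m ℕ.* B) * S₁ m))) + ∑ (upTo (suc k)) (λ m → guard m * (κ m * S₂ m))
      ≡⟨ cong₂ _+_ (removed-largest b k F) (removed-smaller b k F (∑-weight-removeSum b)) ⟩
    removed B k F B + ∑ (upTo b) (removed B k F ∘ suc)
      ≡⟨ trans (ℚP.+-comm (removed B k F B) (∑ (upTo b) (removed B k F ∘ suc))) (sym (∑-upTo-last b (removed B k F ∘ suc))) ⟩
    ∑ (upTo B) (removed B k F ∘ suc) ∎
    where
    open ≡-Reasoning
    B = suc b
    guard : ℕ → ℚ
    guard m = [ m ℕ.* B ≤? k ]
    κ : ℕ → ℚ
    κ = blockWeight B
    rest : ℕ → List (List ℕ)
    rest m = partitions (k ∸ m ℕ.* B) b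
    S₁ S₂ : ℕ → ℚ
    S₁ m = ∑ (rest m) (λ ν → weight ν * F B (replicate (ℕ.pred m) B ++ ν))
    S₂ m = ∑ (rest m) (λ ν → weight ν * removeSum ν (λ j ν′ → F j (replicate m B ++ ν′)))
    distrib : ∀ g κ′ x y → g * (κ′ * (x + y)) ≡ g * (κ′ * x) + g * (κ′ * y)
    distrib = solve-∀ ℚ-ring
    split : ∀ m → ∑ (rest m) (λ ν → weight ν * removeSum (replicate m B ++ ν) F) ≡ toℚ (m ℕ.* B) * S₁ m + S₂ m
    split m = begin
      ∑ (rest m) (λ ν → weight ν * removeSum (replicate m B ++ ν) F)
        ≡⟨ ∑-cong (rest m) (λ ν → trans (cong (weight ν *_) (removeSum-replicate-++ m B ν F)) (distribˡ (weight ν) (toℚ (m ℕ.* B)) (F B (replicate (ℕ.pred m) B ++ ν)) (removeSum ν (λ j ν′ → F j (replicate m B ++ ν′))))) ⟩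
      ∑ (rest m) (λ ν → toℚ (m ℕ.* B) * (weight ν * F B (replicate (ℕ.pred m) B ++ ν)) + weight ν * removeSum ν (λ j ν′ → F j (replicate m B ++ ν′)))
        ≡⟨ ∑-+ (rest m) (λ ν → toℚ (m ℕ.* B) * (weight ν * F B (replicate (ℕ.pred m) B ++ ν))) (λ ν → weight ν * removeSum ν (λ j ν′ → F j (replicate m B ++ ν′))) ⟩
      ∑ (rest m) (λ ν → toℚ (m ℕ.* B) * (weight ν * F B (replicate (ℕ.pred m) B ++ ν))) + S₂ m
        ≡⟨ cong (_+ S₂ m) (sym (∑-*ˡ (toℚ (m ℕ.* B)) (rest m) (λ ν → weight ν * F B (replicate (ℕ.pred m) B ++ ν)))) ⟩
      toℚ (m ℕ.* B) * S₁ m + S₂ m ∎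
      where
      distribˡ : ∀ w t x r → w * (t * x + r) ≡ t * (w * x) + w * r
      distribˡ = solve-∀ ℚ-ring

sum-lowerAt : ∀ {N} (β : Vec ℕ N) v j → j ≤ lookup β v → Vec.sum (lowerAt β v j) ℕ.+ j ≡ Vec.sum β
sum-lowerAt (x ∷ β) zero    j j≤x = begin
  x ∸ j ℕ.+ Vec.sum β ℕ.+ j ≡⟨ ℕP.+-assoc (x ∸ j) (Vec.sum β) j ⟩
  x ∸ j ℕ.+ (Vec.sum β ℕ.+ j) ≡⟨ cong (x ∸ j ℕ.+_) (ℕP.+-comm (Vec.sum β) j) ⟩
  x ∸ j ℕ.+ (j ℕ.+ Vec.sum β) ≡⟨ sym (ℕP.+-assoc (x ∸ j) j (Vec.sum β)) ⟩
  x ∸ j ℕ.+ j ℕ.+ Vec.sum β   ≡⟨ cong (ℕ._+ Vec.sum β) (ℕP.m∸n+n≡m j≤x) ⟩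
  x ℕ.+ Vec.sum β             ∎
  where open ≡-Reasoning
sum-lowerAt (x ∷ β) (suc v) j j≤βv = trans (ℕP.+-assoc x _ j) (cong (x ℕ.+_) (sum-lowerAt β v j j≤βv))

lookup≤sum : ∀ {N} (β : Vec ℕ N) v → lookup β v ≤ Vec.sum β
lookup≤sum (x ∷ β) zero    = ℕP.m≤m+n x (Vec.sum β)
lookup≤sum (x ∷ β) (suc v) = ℕP.≤-trans (lookup≤sum β v) (ℕP.m≤n+m (Vec.sum β) x)

sum-replicate-0 : ∀ N → Vec.sum (Vec.replicate N 0) ≡ 0
sum-replicate-0 zero    = refl
sum-replicate-0 (suc N) = sum-replicate-0 N

sum≡0⇒replicate-0 : ∀ {N} (β : Vec ℕ N) → Vec.sum β ≡ 0 → β ≡ Vec.replicate N 0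
sum≡0⇒replicate-0 []         _    = refl
sum≡0⇒replicate-0 (zero ∷ β) sum≡0 = cong (0 ∷_) (sum≡0⇒replicate-0 β sum≡0)

sum≢0⇒positive-entry : ∀ {N} (β : Vec ℕ N) → Vec.sum β ≢ 0 → Σ (Fin N) (λ v → 1 ≤ lookup β v)
sum≢0⇒positive-entry []          sum≢0 = ⊥-elim (sum≢0 refl)
sum≢0⇒positive-entry (suc x ∷ β) _     = zero , s≤s z≤n
sum≢0⇒positive-entry (zero ∷ β)  sum≢0 with sum≢0⇒positive-entry β sum≢0
... | v , 1≤βv = suc v , 1≤βv

pCoeff-size : ∀ {N} μ (β : Vec ℕ N) → size μ ≢ Vec.sum β → pCoeff μ β ≡ 0ℚ
pCoeff-size {N} []      β 0≢sum = iverson-no (β ≟ᵛ Vec.replicate N 0) (λ β≡0 → 0≢sum (sym (trans (cong Vec.sum β≡0) (sum-replicate-0 N))))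
pCoeff-size {N} (k ∷ μ) β size≢sum = trans (∑-cong (allFin N) (λ v → trans
  (iverson-guard (k ≤? lookup β v) (λ k≤βv → pCoeff-size μ (lowerAt β v k) (λ size≡ → size≢sum
    (trans (cong (k ℕ.+_) size≡) (trans (ℕP.+-comm k _) (sum-lowerAt β v k k≤βv))))))
  (ℚP.*-zeroʳ [ k ≤? lookup β v ]))) (∑-zero (allFin N))

∏ᵛ : ∀ {N} → (ℕ → ℚ) → Vec ℕ N → ℚ
∏ᵛ f []      = 1ℚ
∏ᵛ f (x ∷ β) = f x * ∏ᵛ f β

∏ᵛ-except : ∀ {N} → (ℕ → ℚ) → Vec ℕ N → Fin N → ℚ
∏ᵛ-except f (x ∷ β) zero    = ∏ᵛ f β
∏ᵛ-except f (x ∷ β) (suc v) = f x * ∏ᵛ-except f β v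

∏ᵛ-updateAt : ∀ {N} f (β : Vec ℕ N) v h → ∏ᵛ f (updateAt β v h) ≡ f (h (lookup β v)) * ∏ᵛ-except f β v
∏ᵛ-updateAt f (x ∷ β) zero    h = refl
∏ᵛ-updateAt f (x ∷ β) (suc v) h = trans (cong (f x *_) (∏ᵛ-updateAt f β v h)) (swap (f x) (f (h (lookup β v))) (∏ᵛ-except f β v))
  where
  swap : ∀ a b r → a * (b * r) ≡ b * (a * r)
  swap = solve-∀ ℚ-ring

∏ᵛ-replicate : ∀ N f → f 0 ≡ 1ℚ → ∏ᵛ f (Vec.replicate N 0) ≡ 1ℚ
∏ᵛ-replicate zero    f _      = refl
∏ᵛ-replicate (suc N) f f0≡1 = trans (cong₂ _*_ f0≡1 (∏ᵛ-replicate N f f0≡1)) (ℚP.*-identityˡ 1ℚ)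

module Exponential (c : ℕ → ℚ) where

  open Weighted c

  -- Coefficient of x^β in the degree-k part of exp(Σ_{j ≤ b} c(j) p_j / j).
  expCoeff : ∀ {N} → ℕ → ℕ → Vec ℕ N → ℚ
  expCoeff k b β = ∑ (partitions k b) (λ μ → weight μ * pCoeff μ β)

  expCoeff₁ : ℕ → ℕ → ℚ
  expCoeff₁ b a = expCoeff a b (a ∷ [])

  euler-expCoeff : ∀ {N} b k (β : Vec ℕ N) v → toℚ (lookup β v) * expCoeff k b β ≡
    ∑ (upTo b) (λ i → [ suc i ≤? k ] * (c (suc i) * ([ suc i ≤? lookup β v ] * expCoeff (k ∸ suc i) b (lowerAt β v (suc i)))))
  euler-expCoeff b k β v = begin
    toℚ (lookup β v) * expCoeff k b β
      ≡⟨ ∑-*ˡ (toℚ (lookup β v)) (partitions k b) _ ⟩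
    ∑ (partitions k b) (λ μ → toℚ (lookup β v) * (weight μ * pCoeff μ β))
      ≡⟨ ∑-cong (partitions k b) (λ μ → trans (swap (toℚ (lookup β v)) (weight μ) (pCoeff μ β)) (cong (weight μ *_) (euler-pCoeff μ β v))) ⟩
    ∑ (partitions k b) (λ μ → weight μ * removeSum μ F)
      ≡⟨ ∑-weight-removeSum b k F ⟩
    ∑ (upTo b) (removed b k F ∘ suc)
      ≡⟨ ∑-cong (upTo b) (λ i → cong (λ t → [ suc i ≤? k ] * (c (suc i) * t)) (pull i)) ⟩
    ∑ (upTo b) (λ i → [ suc i ≤? k ] * (c (suc i) * ([ suc i ≤? lookup β v ] * expCoeff (k ∸ suc i) b (lowerAt β v (suc i))))) ∎
    where
    open ≡-Reasoning
    F : ℕ → List ℕ → ℚ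
    F j ν = [ j ≤? lookup β v ] * pCoeff ν (lowerAt β v j)
    swap : ∀ a w x → a * (w * x) ≡ w * (a * x)
    swap = solve-∀ ℚ-ring
    pull : ∀ i → ∑ (partitions (k ∸ suc i) b) (λ ν → weight ν * F (suc i) ν) ≡ [ suc i ≤? lookup β v ] * expCoeff (k ∸ suc i) b (lowerAt β v (suc i))
    pull i = trans (∑-cong (partitions (k ∸ suc i) b) (λ ν → swap (weight ν) [ suc i ≤? lookup β v ] (pCoeff ν (lowerAt β v (suc i)))))
      (sym (∑-*ˡ [ suc i ≤? lookup β v ] (partitions (k ∸ suc i) b) _))

  expCoeff-off-degree : ∀ {N} k b (β : Vec ℕ N) → Vec.sum β ≢ k → expCoeff k b β ≡ 0ℚ
  expCoeff-off-degree k b β sum≢k = trans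
    (∑-cong-All (All.map (λ {μ} (size≡k , _) → trans (cong (weight μ *_) (pCoeff-size μ β (λ size≡sum → sum≢k (trans (sym size≡sum) size≡k)))) (ℚP.*-zeroʳ (weight μ)))
                         (partitions-sound k b)))
    (∑-zero (partitions k b))

  expCoeff-zero : ∀ {N} b (β : Vec ℕ N) → Vec.sum β ≡ 0 → expCoeff 0 b β ≡ 1ℚ
  expCoeff-zero {N} b β sum≡0 = trans (ℚP.+-identityʳ _) (trans (cong (weight [] *_) (iverson-yes (β ≟ᵛ Vec.replicate N 0) (sum≡0⇒replicate-0 β sum≡0))) refl)

  ExpCoeff-∏ : ℕ → ℕ → Set
  ExpCoeff-∏ N k = ∀ b (β : Vec ℕ N) → expCoeff k b β ≡ [ Vec.sum β ≟ k ] * ∏ᵛ (expCoeff₁ b) β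

  expCoeff-lowerAt : ∀ {N} b (β : Vec ℕ N) v i → (∀ {k′} → k′ < Vec.sum β → ExpCoeff-∏ N k′) → suc i ≤ lookup β v →
    expCoeff (Vec.sum β ∸ suc i) b (lowerAt β v (suc i)) ≡ expCoeff₁ b (lookup β v ∸ suc i) * ∏ᵛ-except (expCoeff₁ b) β v
  expCoeff-lowerAt b β v i ih i<βv = begin
    expCoeff (Vec.sum β ∸ suc i) b β′
      ≡⟨ ih (ℕP.∸-monoʳ-< (s≤s z≤n) (ℕP.≤-trans i<βv (lookup≤sum β v))) b β′ ⟩
    [ Vec.sum β′ ≟ Vec.sum β ∸ suc i ] * ∏ᵛ (expCoeff₁ b) β′
      ≡⟨ cong₂ _*_ (iverson-yes (Vec.sum β′ ≟ Vec.sum β ∸ suc i) (trans (sym (ℕP.m+n∸n≡m _ (suc i))) (cong (_∸ suc i) (sum-lowerAt β v (suc i) i<βv))))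
                   (∏ᵛ-updateAt (expCoeff₁ b) β v (_∸ suc i)) ⟩
    1ℚ * (expCoeff₁ b (lookup β v ∸ suc i) * ∏ᵛ-except (expCoeff₁ b) β v)
      ≡⟨ ℚP.*-identityˡ _ ⟩
    expCoeff₁ b (lookup β v ∸ suc i) * ∏ᵛ-except (expCoeff₁ b) β v ∎
    where
    open ≡-Reasoning
    β′ = lowerAt β v (suc i)

  euler-expCoeff-∏ : ∀ {N} b (β : Vec ℕ N) v → (∀ {k′} → k′ < Vec.sum β → ExpCoeff-∏ N k′) →
    toℚ (lookup β v) * expCoeff (Vec.sum β) b β ≡ toℚ (lookup β v) * ∏ᵛ (expCoeff₁ b) β
  euler-expCoeff-∏ b β v ih = begin
    toℚ x * expCoeff k b β                   ≡⟨ euler-expCoeff b k β v ⟩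
    ∑ (upTo b) (λ i → [ suc i ≤? k ] * (c (suc i) * ([ suc i ≤? x ] * expCoeff (k ∸ suc i) b (lowerAt β v (suc i)))))
                                             ≡⟨ ∑-cong (upTo b) term ⟩
    ∑ (upTo b) (λ i → R * U i)               ≡⟨ sym (∑-*ˡ R (upTo b) U) ⟩
    R * ∑ (upTo b) U                         ≡⟨ cong (R *_) (sym (euler-expCoeff b x (x ∷ []) zero)) ⟩
    R * (toℚ x * expCoeff₁ b x)              ≡⟨ swap R (toℚ x) (expCoeff₁ b x) ⟩
    toℚ x * (expCoeff₁ b x * R)              ≡⟨ cong (toℚ x *_) (trans (sym (∏ᵛ-updateAt (expCoeff₁ b) β v id)) (cong (∏ᵛ (expCoeff₁ b)) (VecP.updateAt-id v β))) ⟩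
    toℚ x * ∏ᵛ (expCoeff₁ b) β               ∎
    where
    open ≡-Reasoning
    k = Vec.sum β
    x = lookup β v
    R = ∏ᵛ-except (expCoeff₁ b) β v
    U : ℕ → ℚ
    U i = [ suc i ≤? x ] * (c (suc i) * ([ suc i ≤? x ] * expCoeff₁ b (x ∸ suc i)))
    swap : ∀ r a e → r * (a * e) ≡ a * (e * r)
    swap = solve-∀ ℚ-ring
    rearrange : ∀ r a e → a * (e * r) ≡ r * (a * e)
    rearrange = solve-∀ ℚ-ring
    term : ∀ i → [ suc i ≤? k ] * (c (suc i) * ([ suc i ≤? x ] * expCoeff (k ∸ suc i) b (lowerAt β v (suc i)))) ≡ R * U i
    term i = begin
      [ suc i ≤? k ] * (c (suc i) * ([ suc i ≤? x ] * expCoeff (k ∸ suc i) b (lowerAt β v (suc i))))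
        ≡⟨ iverson-absorb (suc i ≤? k) (suc i ≤? x) (λ i<x → ℕP.≤-trans i<x (lookup≤sum β v)) (c (suc i)) _ ⟩
      [ suc i ≤? x ] * (c (suc i) * expCoeff (k ∸ suc i) b (lowerAt β v (suc i)))
        ≡⟨ iverson-guard (suc i ≤? x) (λ i<x → cong (c (suc i) *_) (expCoeff-lowerAt b β v i ih i<x)) ⟩
      [ suc i ≤? x ] * (c (suc i) * (expCoeff₁ b (x ∸ suc i) * R))
        ≡⟨ cong ([ suc i ≤? x ] *_) (rearrange R (c (suc i)) (expCoeff₁ b (x ∸ suc i))) ⟩
      [ suc i ≤? x ] * (R * (c (suc i) * expCoeff₁ b (x ∸ suc i)))
        ≡⟨ swap′ [ suc i ≤? x ] R _ ⟩
      R * ([ suc i ≤? x ] * (c (suc i) * expCoeff₁ b (x ∸ suc i)))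
        ≡⟨ cong (R *_) (sym (iverson-absorb (suc i ≤? x) (suc i ≤? x) id (c (suc i)) (expCoeff₁ b (x ∸ suc i)))) ⟩
      R * U i ∎
      where
      swap′ : ∀ a b y → a * (b * y) ≡ b * (a * y)
      swap′ = solve-∀ ℚ-ring

  -- exp(Σ_j c(j) p_j / j) = ∏_v exp(Σ_j c(j) x_v^j / j), because p_j = Σ_v x_v^j.
  expCoeff-∏ : ∀ {N} k → ExpCoeff-∏ N k
  expCoeff-∏ {N} = <-rec (ExpCoeff-∏ N) step
    where
    step : ∀ k → (∀ {k′} → k′ < k → ExpCoeff-∏ N k′) → ExpCoeff-∏ N k
    step k ih b β with Vec.sum β ≟ k
    ... | no sum≢k = trans (expCoeff-off-degree k b β sum≢k) (sym (ℚP.*-zeroˡ (∏ᵛ (expCoeff₁ b) β)))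
    ... | yes refl with Vec.sum β ≟ 0
    ...   | yes sum≡0 = begin
      expCoeff (Vec.sum β) b β              ≡⟨ cong (λ t → expCoeff t b β) sum≡0 ⟩
      expCoeff 0 b β                        ≡⟨ expCoeff-zero b β sum≡0 ⟩
      1ℚ                                    ≡⟨ sym (∏ᵛ-replicate N (expCoeff₁ b) (expCoeff-zero b (0 ∷ []) refl)) ⟩
      ∏ᵛ (expCoeff₁ b) (Vec.replicate N 0)  ≡⟨ cong (∏ᵛ (expCoeff₁ b)) (sym (sum≡0⇒replicate-0 β sum≡0)) ⟩
      ∏ᵛ (expCoeff₁ b) β                    ≡⟨ sym (ℚP.*-identityˡ _) ⟩
      1ℚ * ∏ᵛ (expCoeff₁ b) β               ∎
      where open ≡-Reasoning
    ...   | no sum≢0 with sum≢0⇒positive-entry β sum≢0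
    ...     | v , 1≤βv = trans (cancel (lookup β v) refl 1≤βv) (sym (ℚP.*-identityˡ _))
      where
      cancel : ∀ x → lookup β v ≡ x → 1 ≤ x → expCoeff (Vec.sum β) b β ≡ ∏ᵛ (expCoeff₁ b) β
      cancel (suc a) βv≡ _ = toℚ-cancelˡ a (subst (λ x → toℚ x * expCoeff (Vec.sum β) b β ≡ toℚ x * ∏ᵛ (expCoeff₁ b) β) βv≡ (euler-expCoeff-∏ b β v ih))

dWeight : ℕ → ℕ → ℚ
dWeight d j = toℚ d * [ d ∣? j ]

∑-upTo-∣-period : ∀ d → ∑ (upTo (suc d)) (λ i → [ suc d ∣? suc i ]) ≡ 1ℚ
∑-upTo-∣-period d = begin
  ∑ (upTo (suc d)) (λ i → [ suc d ∣? suc i ])         ≡⟨ ∑-upTo-last d (λ i → [ suc d ∣? suc i ]) ⟩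
  ∑ (upTo d) (λ i → [ suc d ∣? suc i ]) + [ suc d ∣? suc d ]
    ≡⟨ cong₂ _+_ (trans (∑-upTo-cong d (λ i<d → iverson-no (suc d ∣? _) (λ d∣ → ℕP.<-irrefl refl (ℕP.<-≤-trans (s≤s i<d) (∣⇒≤ d∣))))) (∑-zero (upTo d)))
                 (iverson-yes (suc d ∣? suc d) ∣-refl) ⟩
  0ℚ + 1ℚ                                             ≡⟨ ℚP.+-identityˡ 1ℚ ⟩
  1ℚ                                                  ∎
  where open ≡-Reasoning

∑-upTo-∣-count : ∀ d q → toℚ (suc d) * ∑ (upTo (q ℕ.* suc d)) (λ i → [ suc d ∣? suc i ]) ≡ toℚ (q ℕ.* suc d)
∑-upTo-∣-count d zero    = ℚP.*-zeroʳ (toℚ (suc d))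
∑-upTo-∣-count d (suc q) = begin
  toℚ D * ∑ (upTo (D ℕ.+ q ℕ.* D)) f                          ≡⟨ cong (toℚ D *_) (∑-upTo-+ D (q ℕ.* D) f) ⟩
  toℚ D * (∑ (upTo D) f + ∑ (upTo (q ℕ.* D)) (λ i → f (D ℕ.+ i))) ≡⟨ cong₂ (λ s t → toℚ D * (s + t)) (∑-upTo-∣-period d) (∑-cong (upTo (q ℕ.* D)) periodic) ⟩
  toℚ D * (1ℚ + ∑ (upTo (q ℕ.* D)) f)                         ≡⟨ ℚP.*-distribˡ-+ (toℚ D) 1ℚ _ ⟩
  toℚ D * 1ℚ + toℚ D * ∑ (upTo (q ℕ.* D)) f                   ≡⟨ cong₂ _+_ (ℚP.*-identityʳ (toℚ D)) (∑-upTo-∣-count d q) ⟩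
  toℚ D + toℚ (q ℕ.* D)                                       ≡⟨ sym (toℚ-+ D (q ℕ.* D)) ⟩
  toℚ (D ℕ.+ q ℕ.* D)                                         ∎
  where
  open ≡-Reasoning
  D = suc d
  f : ℕ → ℚ
  f i = [ D ∣? suc i ]
  periodic : ∀ i → f (D ℕ.+ i) ≡ f i
  periodic i = iverson-⇔ (D ∣? suc (D ℕ.+ i)) (D ∣? suc i) (mk⇔
    (λ D∣ → ∣m+n∣m⇒∣n (subst (D ∣_) (sym (ℕP.+-suc D i)) D∣) ∣-refl)
    (λ D∣ → subst (D ∣_) (ℕP.+-suc D i) (∣m∣n⇒∣m+n ∣-refl D∣)))

iverson-∣-∸ : ∀ d j n → j ≤ n → [ d ∣? j ] * [ d ∣? n ∸ j ] ≡ [ d ∣? j ] * [ d ∣? n ]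
iverson-∣-∸ d j n j≤n = iverson-guard (d ∣? j) (λ d∣j → iverson-⇔ (d ∣? n ∸ j) (d ∣? n) (mk⇔
  (λ d∣n∸j → ∣m∸n∣n⇒∣m d j≤n d∣n∸j d∣j)
  (λ d∣n → ∣m+n∣m⇒∣n (subst (d ∣_) (sym (ℕP.m+[n∸m]≡n j≤n)) d∣n) d∣j)))

module _ (d : ℕ) where

  open Exponential (dWeight (suc d))

  private
    D = suc d

  -- With c(j) = D [D ∣ j] the exponent Σ_j c(j) t^j / j is -log(1 - t^D), whose exponential is Σ_q t^(qD).
  expCoeff₁-dWeight : ∀ b n → n ≤ b → expCoeff₁ b n ≡ [ D ∣? n ]
  expCoeff₁-dWeight b = <-rec (λ n → n ≤ b → expCoeff₁ b n ≡ [ D ∣? n ]) step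
    where
    step : ∀ n → (∀ {n′} → n′ < n → n′ ≤ b → expCoeff₁ b n′ ≡ [ D ∣? n′ ]) → n ≤ b → expCoeff₁ b n ≡ [ D ∣? n ]
    step zero     _  _   = trans (expCoeff-zero b (0 ∷ []) refl) (sym (iverson-yes (D ∣? 0) (D ∣0)))
    step (suc n′) ih n≤b = toℚ-cancelˡ n′ (begin
      toℚ n * expCoeff₁ b n
        ≡⟨ euler-expCoeff b n (n ∷ []) zero ⟩
      ∑ (upTo b) (λ i → [ suc i ≤? n ] * (dWeight D (suc i) * ([ suc i ≤? n ] * expCoeff₁ b (n ∸ suc i))))
        ≡⟨ ∑-cong (upTo b) term ⟩
      ∑ (upTo b) (λ i → [ suc i ≤? n ] * (toℚ D * ([ D ∣? suc i ] * [ D ∣? n ])))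
        ≡⟨ ∑-upTo-truncate n b _ n≤b ⟩
      ∑ (upTo n) (λ i → toℚ D * ([ D ∣? suc i ] * [ D ∣? n ]))
        ≡⟨ ∑-cong (upTo n) (λ i → regroup (toℚ D) [ D ∣? suc i ] [ D ∣? n ]) ⟩
      ∑ (upTo n) (λ i → [ D ∣? n ] * (toℚ D * [ D ∣? suc i ]))
        ≡⟨ sym (∑-*ˡ [ D ∣? n ] (upTo n) _) ⟩
      [ D ∣? n ] * ∑ (upTo n) (λ i → toℚ D * [ D ∣? suc i ])
        ≡⟨ iverson-guard (D ∣? n) multiples ⟩
      [ D ∣? n ] * toℚ n
        ≡⟨ ℚP.*-comm [ D ∣? n ] (toℚ n) ⟩
      toℚ n * [ D ∣? n ] ∎)
      where
      open ≡-Reasoning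
      n = suc n′
      regroup : ∀ a x y → a * (x * y) ≡ y * (a * x)
      regroup = solve-∀ ℚ-ring
      term : ∀ i → [ suc i ≤? n ] * (dWeight D (suc i) * ([ suc i ≤? n ] * expCoeff₁ b (n ∸ suc i)))
                 ≡ [ suc i ≤? n ] * (toℚ D * ([ D ∣? suc i ] * [ D ∣? n ]))
      term i = trans (iverson-absorb (suc i ≤? n) (suc i ≤? n) id (dWeight D (suc i)) _)
        (iverson-guard (suc i ≤? n) (λ i<n → begin
          (toℚ D * [ D ∣? suc i ]) * expCoeff₁ b (n ∸ suc i)    ≡⟨ cong ((toℚ D * [ D ∣? suc i ]) *_) (ih (ℕP.∸-monoʳ-< (s≤s z≤n) i<n) (ℕP.≤-trans (ℕP.m∸n≤m n (suc i)) n≤b)) ⟩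
          (toℚ D * [ D ∣? suc i ]) * [ D ∣? n ∸ suc i ]          ≡⟨ ℚP.*-assoc (toℚ D) [ D ∣? suc i ] [ D ∣? n ∸ suc i ] ⟩
          toℚ D * ([ D ∣? suc i ] * [ D ∣? n ∸ suc i ])          ≡⟨ cong (toℚ D *_) (iverson-∣-∸ D (suc i) n i<n) ⟩
          toℚ D * ([ D ∣? suc i ] * [ D ∣? n ])                  ∎))
      multiples : D ∣ n → ∑ (upTo n) (λ i → toℚ D * [ D ∣? suc i ]) ≡ toℚ n
      multiples (divides q n≡qD) = begin
        ∑ (upTo n) (λ i → toℚ D * [ D ∣? suc i ])             ≡⟨ sym (∑-*ˡ (toℚ D) (upTo n) _) ⟩
        toℚ D * ∑ (upTo n) (λ i → [ D ∣? suc i ])             ≡⟨ cong (λ t → toℚ D * ∑ (upTo t) (λ i → [ D ∣? suc i ])) n≡qD ⟩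
        toℚ D * ∑ (upTo (q ℕ.* D)) (λ i → [ D ∣? suc i ])     ≡⟨ ∑-upTo-∣-count d q ⟩
        toℚ (q ℕ.* D)                                         ≡⟨ cong toℚ (sym n≡qD) ⟩
        toℚ n                                                 ∎

  ∏ᵛ-expCoeff₁-dWeight : ∀ b {N} (α : Vec ℕ N) → Vec.sum α ≤ b → ∏ᵛ (expCoeff₁ b) α ≡ ∏ᵛ (λ x → [ D ∣? x ]) α
  ∏ᵛ-expCoeff₁-dWeight b []      _       = refl
  ∏ᵛ-expCoeff₁-dWeight b (x ∷ α) x+α≤b = cong₂ _*_
    (expCoeff₁-dWeight b x (ℕP.≤-trans (ℕP.m≤m+n x (Vec.sum α)) x+α≤b))
    (∏ᵛ-expCoeff₁-dWeight b α (ℕP.≤-trans (ℕP.m≤n+m (Vec.sum α) x) x+α≤b))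

nonzero : ∀ {N} → Vec ℕ N → List ℕ
nonzero α = filter (λ x → ¬? (x ≟ 0)) (toList α)

_≟ˡ_ : (xs ys : List ℕ) → Dec (xs ≡ ys)
_≟ˡ_ = ListP.≡-dec _≟_

iverson-≟ˡ-∷ : ∀ a x ν s → [ (a ∷ ν) ≟ˡ (x ∷ s) ] ≡ [ a ≟ x ] * [ ν ≟ˡ s ]
iverson-≟ˡ-∷ a x ν s = iverson-× ((a ∷ ν) ≟ˡ (x ∷ s)) (a ≟ x) (ν ≟ˡ s) (mk⇔ ListP.∷-injective (λ (a≡x , ν≡s) → cong₂ _∷_ a≡x ν≡s))

∑-parts-δ : ∀ f k b s → k ≤ f → Descending b s → sum s ≡ k → ∑ (parts f k b) (λ λs → [ λs ≟ˡ s ]) ≡ 1ℚ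
∑-parts-δ f       zero    b []        _ _ _ = refl
∑-parts-δ f       zero    b (x ∷ s)   _ ((1≤x , _) , _) x+s≡0 = ⊥-elim (ℕP.<-irrefl (sym x+s≡0) (ℕP.≤-trans 1≤x (ℕP.m≤m+n x (sum s))))
∑-parts-δ (suc g) (suc n) b (suc x ∷ s) (s≤s n≤g) ((_ , x<b) , s↓) x+s≡n = begin
  ∑ (parts (suc g) (suc n) b) (λ λs → [ λs ≟ˡ (suc x ∷ s) ])
    ≡⟨ ∑-parts-suc g n b _ ⟩
  ∑ (upTo b) (λ i → [ suc i ≤? suc n ] * ∑ (parts g (n ∸ i) (suc i)) (λ ν → [ (suc i ∷ ν) ≟ˡ (suc x ∷ s) ]))
    ≡⟨ ∑-cong (upTo b) (λ i → cong ([ suc i ≤? suc n ] *_) (trans (∑-cong (parts g (n ∸ i) (suc i)) (λ ν → trans (iverson-≟ˡ-∷ (suc i) (suc x) ν s)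
         (cong (_* [ ν ≟ˡ s ]) (iverson-⇔ (suc i ≟ suc x) (i ≟ x) (mk⇔ ℕP.suc-injective (cong suc)))))) (sym (∑-*ˡ [ i ≟ x ] (parts g (n ∸ i) (suc i)) (λ ν → [ ν ≟ˡ s ]))))) ⟩
  ∑ (upTo b) (λ i → [ suc i ≤? suc n ] * ([ i ≟ x ] * T i))
    ≡⟨ ∑-cong (upTo b) (λ i → trans (swap [ suc i ≤? suc n ] [ i ≟ x ] (T i)) (iverson-≡ (i ≟ x) (λ j → [ suc j ≤? suc n ] * T j))) ⟩
  ∑ (upTo b) (λ i → [ i ≟ x ] * ([ suc x ≤? suc n ] * T x))
    ≡⟨ sym (∑-*ʳ _ (upTo b) (λ i → [ i ≟ x ])) ⟩
  ∑ (upTo b) (λ i → [ i ≟ x ]) * ([ suc x ≤? suc n ] * T x)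
    ≡⟨ cong₂ _*_ (count b x<b) (cong₂ _*_ (iverson-yes (suc x ≤? suc n) (subst (suc x ≤_) x+s≡n (ℕP.m≤m+n (suc x) (sum s))))
                                         (∑-parts-δ g (n ∸ x) (suc x) s (ℕP.≤-trans (ℕP.m∸n≤m n x) n≤g) s↓ sum≡)) ⟩
  1ℚ * (1ℚ * 1ℚ) ∎
  where
  open ≡-Reasoning
  T : ℕ → ℚ
  T i = ∑ (parts g (n ∸ i) (suc i)) (λ ν → [ ν ≟ˡ s ])
  swap : ∀ a b x → a * (b * x) ≡ b * (a * x)
  swap = solve-∀ ℚ-ring
  sum≡ : sum s ≡ n ∸ x
  sum≡ = trans (sym (ℕP.m+n∸m≡n x (sum s))) (cong (_∸ x) (ℕP.suc-injective x+s≡n))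
  count : ∀ b → suc x ≤ b → ∑ (upTo b) (λ i → [ i ≟ x ]) ≡ 1ℚ
  count (suc b) (s≤s x≤b) = trans (∑-upTo-δ b x) (iverson-yes (x ≤? b) x≤b)

∑-partitions-δ : ∀ k b s (Φ : List ℕ → ℚ) → Descending b s → sum s ≡ k → ∑ (partitions k b) (λ λs → Φ λs * [ λs ≟ˡ s ]) ≡ Φ s
∑-partitions-δ k b s Φ s↓ sum≡k = begin
  ∑ (partitions k b) (λ λs → Φ λs * [ λs ≟ˡ s ])   ≡⟨ ∑-cong (partitions k b) (λ λs → trans (ℚP.*-comm (Φ λs) _) (iverson-≡ (λs ≟ˡ s) Φ)) ⟩
  ∑ (partitions k b) (λ λs → [ λs ≟ˡ s ] * Φ s)    ≡⟨ sym (∑-*ʳ (Φ s) (partitions k b) _) ⟩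
  ∑ (partitions k b) (λ λs → [ λs ≟ˡ s ]) * Φ s    ≡⟨ cong (_* Φ s) (∑-parts-δ k k b s ℕP.≤-refl s↓ sum≡k) ⟩
  1ℚ * Φ s                                        ≡⟨ ℚP.*-identityˡ (Φ s) ⟩
  Φ s                                             ∎
  where open ≡-Reasoning

∑-partitions-δ-off : ∀ k b s (Φ : List ℕ → ℚ) → sum s ≢ k → ∑ (partitions k b) (λ λs → Φ λs * [ λs ≟ˡ s ]) ≡ 0ℚ
∑-partitions-δ-off k b s Φ sum≢k = trans
  (∑-cong-All (All.map (λ {λs} (sum≡k , _) → trans (cong (Φ λs *_) (iverson-no (λs ≟ˡ s) (λ λs≡s → sum≢k (trans (cong sum (sym λs≡s)) sum≡k)))) (ℚP.*-zeroʳ (Φ λs)))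
                       (partitions-sound k b)))
  (∑-zero (partitions k b))

descSort : List ℕ → List ℕ
descSort = InsertionSort.sort ≥-decTotalOrder

SortedDesc : List ℕ → Set
SortedDesc = Sorted (DecTotalOrder.totalOrder ≥-decTotalOrder)

SortedAsc : List ℕ → Set
SortedAsc = Sorted ℕP.≤-totalOrder

sortedDesc-unique : ∀ {xs ys} → SortedDesc xs → SortedDesc ys → xs ↭ ys → xs ≡ ys
sortedDesc-unique xs↘ ys↘ xs↭ys = Pointwise-≡⇒≡ (SortedP.↗↭↗⇒≋ (DecTotalOrder.totalOrder ≥-decTotalOrder) xs↘ ys↘ (↭⇒↭ₛ xs↭ys))

sortedAsc-unique : ∀ {xs ys} → SortedAsc xs → SortedAsc ys → xs ↭ ys → xs ≡ ys
sortedAsc-unique xs↗ ys↗ xs↭ys = Pointwise-≡⇒≡ (SortedP.↗↭↗⇒≋ ℕP.≤-totalOrder xs↗ ys↗ (↭⇒↭ₛ xs↭ys))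

sort-↭ : ∀ xs → sort xs ↭ xs
sort-↭ = InsertionSortP.sort-↭ ℕP.≤-decTotalOrder

descSort-↭ : ∀ xs → descSort xs ↭ xs
descSort-↭ = InsertionSortP.sort-↭ ≥-decTotalOrder

descending⇒sortedDesc : ∀ b λs → Descending b λs → SortedDesc λs
descending⇒sortedDesc b []           _                    = []
descending⇒sortedDesc b (x ∷ [])     _                    = [-]
descending⇒sortedDesc b (x ∷ y ∷ λs) (_ , (y⁺ , y≤x) , λs↓) = y≤x ∷ descending⇒sortedDesc x (y ∷ λs) ((y⁺ , y≤x) , λs↓)

sortedDesc⇒descending : ∀ b s → SortedDesc s → All (1 ≤_) s → All (_≤ b) s → Descending b s
sortedDesc⇒descending b []      _  _  _          = tt
sortedDesc⇒descending b (x ∷ s) s↘ s⁺ (x≤b ∷ _) = from-head b x s s↘ s⁺ x≤b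
  where
  from-head : ∀ b x s → SortedDesc (x ∷ s) → All (1 ≤_) (x ∷ s) → x ≤ b → Descending b (x ∷ s)
  from-head b x []      _           (x⁺ ∷ [])  x≤b = (x⁺ , x≤b) , tt
  from-head b x (y ∷ s) (y≤x ∷ s↘) (x⁺ ∷ s⁺) x≤b = (x⁺ , x≤b) , from-head x y s s↘ s⁺ y≤x

-- m λ α compares sorted lists; for a descending λ this says λ is the descending rearrangement of the nonzero entries of α.
m≡[descSort] : ∀ {N} b λs (α : Vec ℕ N) → Descending b λs → m λs α ≡ [ λs ≟ˡ descSort (nonzero α) ]
m≡[descSort] b λs α λs↓ = iverson-⇔ (sort (nonzero α) ≟ˡ sort λs) (λs ≟ˡ descSort (nonzero α)) (mk⇔
  (λ sorts≡ → sortedDesc-unique (descending⇒sortedDesc b λs λs↓) (InsertionSortP.sort-↗ ≥-decTotalOrder (nonzero α))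
     (↭-trans (↭-sym (sort-↭ λs)) (↭-trans (subst (_↭ nonzero α) sorts≡ (sort-↭ (nonzero α))) (↭-sym (descSort-↭ (nonzero α))))))
  (λ { refl → sortedAsc-unique (InsertionSortP.sort-↗ ℕP.≤-decTotalOrder (nonzero α)) (InsertionSortP.sort-↗ ℕP.≤-decTotalOrder (descSort (nonzero α)))
     (↭-trans (sort-↭ (nonzero α)) (↭-trans (↭-sym (descSort-↭ (nonzero α))) (↭-sym (sort-↭ (descSort (nonzero α)))))) }))

private
  nonzero-∷-zero : ∀ {N} (α : Vec ℕ N) → nonzero (0 ∷ α) ≡ nonzero α
  nonzero-∷-zero α = ListP.filter-reject (λ x → ¬? (x ≟ 0)) {x = 0} {xs = toList α} (λ 0≢0 → 0≢0 refl)

  nonzero-∷-suc : ∀ {N} x (α : Vec ℕ N) → nonzero (suc x ∷ α) ≡ suc x ∷ nonzero α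
  nonzero-∷-suc x α = ListP.filter-accept (λ x → ¬? (x ≟ 0)) {x = suc x} {xs = toList α} (λ ())

sum-nonzero : ∀ {N} (α : Vec ℕ N) → sum (nonzero α) ≡ Vec.sum α
sum-nonzero []          = refl
sum-nonzero (zero ∷ α)  = trans (cong sum (nonzero-∷-zero α)) (sum-nonzero α)
sum-nonzero (suc x ∷ α) = trans (cong sum (nonzero-∷-suc x α)) (cong (suc x ℕ.+_) (sum-nonzero α))

nonzero-positive : ∀ {N} (α : Vec ℕ N) → All (1 ≤_) (nonzero α)
nonzero-positive []          = []
nonzero-positive (zero ∷ α)  = subst (All (1 ≤_)) (sym (nonzero-∷-zero α)) (nonzero-positive α)
nonzero-positive (suc x ∷ α) = subst (All (1 ≤_)) (sym (nonzero-∷-suc x α)) (s≤s z≤n ∷ nonzero-positive α)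

All-≤-sum : ∀ xs → All (_≤ sum xs) xs
All-≤-sum []       = []
All-≤-sum (x ∷ xs) = ℕP.m≤m+n x (sum xs) ∷ All.map (λ y≤ → ℕP.≤-trans y≤ (ℕP.m≤n+m (sum xs) x)) (All-≤-sum xs)

iverson-all-∷ : ∀ {P : ℕ → Set} (P? : Decidable P) x xs → [ All.all? P? (x ∷ xs) ] ≡ [ P? x ] * [ All.all? P? xs ]
iverson-all-∷ P? x xs = iverson-× (All.all? P? (x ∷ xs)) (P? x) (All.all? P? xs) (mk⇔ (λ pxs → All.head pxs , All.tail pxs) (λ (px , pxs) → px ∷ pxs))

∏ᵛ-∣≡all-nonzero : ∀ d {N} (α : Vec ℕ N) → ∏ᵛ (λ x → [ d ∣? x ]) α ≡ [ All.all? (d ∣?_) (nonzero α) ]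
∏ᵛ-∣≡all-nonzero d []          = refl
∏ᵛ-∣≡all-nonzero d (zero ∷ α)  = trans (cong₂ _*_ (iverson-yes (d ∣? 0) (d ∣0)) (∏ᵛ-∣≡all-nonzero d α))
  (trans (ℚP.*-identityˡ _) (cong (λ xs → [ All.all? (d ∣?_) xs ]) (sym (nonzero-∷-zero α))))
∏ᵛ-∣≡all-nonzero d (suc x ∷ α) = trans (cong ([ d ∣? suc x ] *_) (∏ᵛ-∣≡all-nonzero d α))
  (trans (sym (iverson-all-∷ (d ∣?_) (suc x) (nonzero α))) (cong (λ xs → [ All.all? (d ∣?_) xs ]) (sym (nonzero-∷-suc x α))))

∑-partitions-m : ∀ {N} n (Φ : List ℕ → ℚ) → (∀ {xs ys} → xs ↭ ys → Φ xs ≡ Φ ys) → (α : Vec ℕ N) →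
  ∑ (partitions n n) (λ λs → Φ λs * m λs α) ≡ [ Vec.sum α ≟ n ] * Φ (nonzero α)
∑-partitions-m n Φ Φ-↭ α = trans
  (∑-cong-All (All.map (λ {λs} (_ , λs↓) → cong (Φ λs *_) (m≡[descSort] n λs α λs↓)) (partitions-sound n n)))
  (select (Vec.sum α ≟ n))
  where
  s = descSort (nonzero α)
  sum-s : sum s ≡ Vec.sum α
  sum-s = trans (ListActionP.sum-↭ (descSort-↭ (nonzero α))) (sum-nonzero α)
  select : (d : Dec (Vec.sum α ≡ n)) → ∑ (partitions n n) (λ λs → Φ λs * [ λs ≟ˡ s ]) ≡ [ d ] * Φ (nonzero α)
  select (no sum≢n)    = trans (∑-partitions-δ-off n n s Φ (λ sum≡n → sum≢n (trans (sym sum-s) sum≡n))) (sym (ℚP.*-zeroˡ (Φ (nonzero α))))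
  select (yes refl) = trans (∑-partitions-δ (Vec.sum α) (Vec.sum α) s Φ s↓ sum-s) (trans (Φ-↭ (descSort-↭ (nonzero α))) (sym (ℚP.*-identityˡ (Φ (nonzero α)))))
    where
    s↓ : Descending (Vec.sum α) s
    s↓ = sortedDesc⇒descending (Vec.sum α) s (InsertionSortP.sort-↗ ≥-decTotalOrder (nonzero α))
      (PermP.All-resp-↭ (↭-sym (descSort-↭ (nonzero α))) (nonzero-positive α))
      (PermP.All-resp-↭ (↭-sym (descSort-↭ (nonzero α))) (subst (λ t → All (_≤ t) (nonzero α)) (sum-nonzero α) (All-≤-sum (nonzero α))))

∣gcdL⇔All∣ : ∀ d xs → d ∣ gcdL xs ⇔ All (d ∣_) xs
∣gcdL⇔All∣ d []       = mk⇔ (λ _ → []) (λ _ → d ∣0)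
∣gcdL⇔All∣ d (x ∷ xs) = mk⇔
  (λ d∣g → ∣-trans d∣g (gcd[m,n]∣m x (gcdL xs)) ∷ to (∣-trans d∣g (gcd[m,n]∣n x (gcdL xs))))
  (λ d∣all → gcd-greatest (All.head d∣all) (from (All.tail d∣all)))
  where open Equivalence (∣gcdL⇔All∣ d xs)

iverson-∣gcdL : ∀ d xs → [ d ∣? gcdL xs ] ≡ [ All.all? (d ∣?_) xs ]
iverson-∣gcdL d xs = iverson-⇔ (d ∣? gcdL xs) (All.all? (d ∣?_) xs) (∣gcdL⇔All∣ d xs)

gcdL-bounds : ∀ n λs → IsPartition n n λs → 1 ≤ n → 1 ≤ gcdL λs × gcdL λs ≤ n
gcdL-bounds n []           (refl , _)             1≤0 = ⊥-elim (ℕP.<-irrefl refl 1≤0)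
gcdL-bounds n (suc x ∷ λs) (_ , (_ , x<n) , _) _   =
  ℕP.n≢0⇒n>0 (λ g≡0 → ℕP.1+n≢0 (gcd[m,n]≡0⇒m≡0 {suc x} {gcdL λs} g≡0)) ,
  ℕP.≤-trans (∣⇒≤ (gcd[m,n]∣m (suc x) (gcdL λs))) x<n

toℚ-sum-map : ∀ (h : ℕ → ℕ) xs → toℚ (sum (map h xs)) ≡ ∑ xs (λ x → toℚ (h x))
toℚ-sum-map h []       = refl
toℚ-sum-map h (x ∷ xs) = trans (toℚ-+ (h x) (sum (map h xs))) (cong (toℚ (h x) +_) (toℚ-sum-map h xs))

∑-divisors : ∀ g n (h : ℕ → ℚ) → 1 ≤ g → g ≤ n → ∑ (divisors g) h ≡ ∑ (upTo n) (λ i → [ suc i ∣? g ] * h (suc i))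
∑-divisors (suc g′) n h _ g≤n = begin
  ∑ (filter (_∣? g) (map suc (upTo g))) h          ≡⟨ ∑-filter (_∣? g) (map suc (upTo g)) h ⟩
  ∑ (map suc (upTo g)) (λ d → [ d ∣? g ] * h d)   ≡⟨ ∑-map suc (upTo g) (λ d → [ d ∣? g ] * h d) ⟩
  ∑ (upTo g) F                                    ≡⟨ sym (∑-upTo-vanishing g n F beyond g≤n) ⟩
  ∑ (upTo n) F                                    ∎
  where
  open ≡-Reasoning
  g = suc g′
  F : ℕ → ℚ
  F i = [ suc i ∣? g ] * h (suc i)
  beyond : ∀ i → g ≤ i → F i ≡ 0ℚ
  beyond i g≤i = trans (cong (_* h (suc i)) (iverson-no (suc i ∣? g) (λ i<g → ℕP.<-irrefl refl (ℕP.<-≤-trans (s≤s g≤i) (∣⇒≤ i<g))))) (ℚP.*-zeroˡ (h (suc i)))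

cProd-dWeight : ∀ d λs → Weighted.cProd (dWeight d) λs ≡ toℚ (d ^ length λs) * [ All.all? (d ∣?_) λs ]
cProd-dWeight d []       = refl
cProd-dWeight d (x ∷ λs) = begin
  (toℚ d * [ d ∣? x ]) * Weighted.cProd (dWeight d) λs                       ≡⟨ cong ((toℚ d * [ d ∣? x ]) *_) (cProd-dWeight d λs) ⟩
  (toℚ d * [ d ∣? x ]) * (toℚ (d ^ length λs) * [ All.all? (d ∣?_) λs ])     ≡⟨ medial (toℚ d) [ d ∣? x ] (toℚ (d ^ length λs)) [ All.all? (d ∣?_) λs ] ⟩
  (toℚ d * toℚ (d ^ length λs)) * ([ d ∣? x ] * [ All.all? (d ∣?_) λs ])     ≡⟨ cong₂ _*_ (sym (toℚ-* d (d ^ length λs))) (sym (iverson-all-∷ (d ∣?_) x λs)) ⟩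
  toℚ (d ^ length (x ∷ λs)) * [ All.all? (d ∣?_) (x ∷ λs) ]                  ∎
  where
  open ≡-Reasoning
  medial : ∀ a b c e → (a * b) * (c * e) ≡ (a * c) * (b * e)
  medial = solve-∀ ℚ-ring

-- σ_{ℓ-1}(g)/z_λ = Σ_{d ∣ g} d^{ℓ-1}/z_λ = Σ_d (1/d) · d^ℓ [d ∣ all parts] / z_λ.
σ/z≡∑-weight : ∀ n λs → IsPartition n n λs → 1 ≤ n →
  toℚ (σ (len λs ∸ 1) (gcdL λs)) * inv (z λs) ≡ ∑ (upTo n) (λ i → inv (suc i) * Weighted.weight (dWeight (suc i)) λs)
σ/z≡∑-weight n []       (refl , _) 1≤0 = ⊥-elim (ℕP.<-irrefl refl 1≤0)
σ/z≡∑-weight n (x ∷ λ′) λs⊢n       1≤n = begin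
  toℚ (σ r g) * inv (z λs)
    ≡⟨ cong (_* inv (z λs)) (trans (toℚ-sum-map (_^ r) (divisors g)) (∑-divisors g n (λ d → toℚ (d ^ r)) 1≤g g≤n)) ⟩
  ∑ (upTo n) (λ i → [ suc i ∣? g ] * toℚ (suc i ^ r)) * inv (z λs)
    ≡⟨ ∑-*ʳ (inv (z λs)) (upTo n) _ ⟩
  ∑ (upTo n) (λ i → ([ suc i ∣? g ] * toℚ (suc i ^ r)) * inv (z λs))
    ≡⟨ ∑-cong (upTo n) term ⟩
  ∑ (upTo n) (λ i → inv (suc i) * Weighted.weight (dWeight (suc i)) λs) ∎
  where
  open ≡-Reasoning
  λs = x ∷ λ′
  r = length λ′
  g = gcdL λs
  1≤g = proj₁ (gcdL-bounds n λs λs⊢n 1≤n)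
  g≤n = proj₂ (gcdL-bounds n λs λs⊢n 1≤n)
  term : ∀ i → ([ suc i ∣? g ] * toℚ (suc i ^ r)) * inv (z λs) ≡ inv (suc i) * Weighted.weight (dWeight (suc i)) λs
  term i = begin
    ([ suc i ∣? g ] * toℚ (suc i ^ r)) * inv (z λs)
      ≡⟨ cong (λ t → (t * toℚ (suc i ^ r)) * inv (z λs)) (iverson-∣gcdL (suc i) λs) ⟩
    (A * toℚ (suc i ^ r)) * inv (z λs)
      ≡⟨ sym (ℚP.*-identityˡ _) ⟩
    1ℚ * ((A * toℚ (suc i ^ r)) * inv (z λs))
      ≡⟨ cong (_* ((A * toℚ (suc i ^ r)) * inv (z λs))) (sym (toℚ-inverse i)) ⟩
    (toℚ (suc i) * inv (suc i)) * ((A * toℚ (suc i ^ r)) * inv (z λs))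
      ≡⟨ rearrange (toℚ (suc i)) (inv (suc i)) A (toℚ (suc i ^ r)) (inv (z λs)) ⟩
    inv (suc i) * (((toℚ (suc i) * toℚ (suc i ^ r)) * A) * inv (z λs))
      ≡⟨ cong (λ t → inv (suc i) * ((t * A) * inv (z λs))) (sym (toℚ-* (suc i) (suc i ^ r))) ⟩
    inv (suc i) * ((toℚ (suc i ^ suc r) * A) * inv (z λs))
      ≡⟨ cong (λ t → inv (suc i) * (t * inv (z λs))) (sym (cProd-dWeight (suc i) λs)) ⟩
    inv (suc i) * Weighted.weight (dWeight (suc i)) λs ∎
    where
    A = [ All.all? (suc i ∣?_) λs ]
    rearrange : ∀ t s a q w → (t * s) * ((a * q) * w) ≡ s * (((t * q) * a) * w)
    rearrange = solve-∀ ℚ-ring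

σ₋₁-gcdL : ∀ n λs → IsPartition n n λs → 1 ≤ n → σ₋₁ (gcdL λs) ≡ ∑ (upTo n) (λ i → inv (suc i) * [ All.all? (suc i ∣?_) λs ])
σ₋₁-gcdL n λs λs⊢n 1≤n = begin
  sumℚ (map inv (divisors (gcdL λs)))                       ≡⟨ sumℚ-map inv (divisors (gcdL λs)) ⟩
  ∑ (divisors (gcdL λs)) inv                                ≡⟨ ∑-divisors (gcdL λs) n inv (proj₁ bounds) (proj₂ bounds) ⟩
  ∑ (upTo n) (λ i → [ suc i ∣? gcdL λs ] * inv (suc i))     ≡⟨ ∑-cong (upTo n) (λ i → trans (cong (_* inv (suc i)) (iverson-∣gcdL (suc i) λs)) (ℚP.*-comm _ (inv (suc i)))) ⟩
  ∑ (upTo n) (λ i → inv (suc i) * [ All.all? (suc i ∣?_) λs ]) ∎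
  where
  open ≡-Reasoning
  bounds = gcdL-bounds n λs λs⊢n 1≤n

sumS-map : ∀ {N} {A : Set} (g : A → Ser N) xs (α : Vec ℕ N) → sumS (map g xs) α ≡ ∑ xs (λ x → g x α)
sumS-map g []       α = refl
sumS-map g (x ∷ xs) α = cong (g x α +_) (sumS-map g xs α)

H≡∑-divisible : ∀ n → 1 ≤ n → ∀ {N} (α : Vec ℕ N) →
  H n α ≡ ∑ (upTo n) (λ i → inv (suc i) * ([ Vec.sum α ≟ n ] * ∏ᵛ (λ x → [ suc i ∣? x ]) α))
H≡∑-divisible n 1≤n α = begin
  H n α
    ≡⟨ sumS-map (λ λs → (toℚ (σ (len λs ∸ 1) (gcdL λs)) * inv (z λs)) · pL λs) (partitions n n) α ⟩
  ∑ (partitions n n) (λ λs → (toℚ (σ (len λs ∸ 1) (gcdL λs)) * inv (z λs)) * pL λs α)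
    ≡⟨ ∑-cong-All (All.map (λ {λs} λs⊢n → cong₂ _*_ (σ/z≡∑-weight n λs λs⊢n 1≤n) (pL≡pCoeff λs α)) (partitions-sound n n)) ⟩
  ∑ (partitions n n) (λ λs → ∑ (upTo n) (λ i → inv (suc i) * Weighted.weight (dWeight (suc i)) λs) * pCoeff λs α)
    ≡⟨ ∑-∑-* (partitions n n) (upTo n) (λ i → inv (suc i)) (λ λs i → Weighted.weight (dWeight (suc i)) λs) (λ λs → pCoeff λs α) ⟩
  ∑ (upTo n) (λ i → inv (suc i) * Exponential.expCoeff (dWeight (suc i)) n n α)
    ≡⟨ ∑-cong (upTo n) (λ i → cong (inv (suc i) *_) (trans (Exponential.expCoeff-∏ (dWeight (suc i)) n n α)
         (iverson-guard (Vec.sum α ≟ n) (λ sum≡n → ∏ᵛ-expCoeff₁-dWeight i n α (ℕP.≤-reflexive sum≡n))))) ⟩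
  ∑ (upTo n) (λ i → inv (suc i) * ([ Vec.sum α ≟ n ] * ∏ᵛ (λ x → [ suc i ∣? x ]) α)) ∎
  where open ≡-Reasoning

Mexp≡∑-divisible : ∀ n → 1 ≤ n → ∀ {N} (α : Vec ℕ N) →
  Mexp n α ≡ ∑ (upTo n) (λ i → inv (suc i) * ([ Vec.sum α ≟ n ] * ∏ᵛ (λ x → [ suc i ∣? x ]) α))
Mexp≡∑-divisible n 1≤n α = begin
  Mexp n α
    ≡⟨ sumS-map (λ λs → σ₋₁ (gcdL λs) · m λs) (partitions n n) α ⟩
  ∑ (partitions n n) (λ λs → σ₋₁ (gcdL λs) * m λs α)
    ≡⟨ ∑-cong-All (All.map (λ {λs} λs⊢n → cong (_* m λs α) (σ₋₁-gcdL n λs λs⊢n 1≤n)) (partitions-sound n n)) ⟩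
  ∑ (partitions n n) (λ λs → ∑ (upTo n) (λ i → inv (suc i) * [ All.all? (suc i ∣?_) λs ]) * m λs α)
    ≡⟨ ∑-∑-* (partitions n n) (upTo n) (λ i → inv (suc i)) (λ λs i → [ All.all? (suc i ∣?_) λs ]) (λ λs → m λs α) ⟩
  ∑ (upTo n) (λ i → inv (suc i) * ∑ (partitions n n) (λ λs → [ All.all? (suc i ∣?_) λs ] * m λs α))
    ≡⟨ ∑-cong (upTo n) (λ i → cong (inv (suc i) *_) (trans
         (∑-partitions-m n (λ λs → [ All.all? (suc i ∣?_) λs ]) (λ xs↭ys → iverson-⇔ (All.all? _ _) (All.all? _ _) (mk⇔ (PermP.All-resp-↭ xs↭ys) (PermP.All-resp-↭ (↭-sym xs↭ys)))) α)
         (cong ([ Vec.sum α ≟ n ] *_) (sym (∏ᵛ-∣≡all-nonzero (suc i) α))))) ⟩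
  ∑ (upTo n) (λ i → inv (suc i) * ([ Vec.sum α ≟ n ] * ∏ᵛ (λ x → [ suc i ∣? x ]) α)) ∎
  where open ≡-Reasoning

mainTheorem11 : (n : ℕ) → 1 ≤ n → (N : ℕ) → (α : Vec ℕ N) → H n α ≡ Mexp n α
mainTheorem11 n 1≤n N α = trans (H≡∑-divisible n 1≤n α) (sym (Mexp≡∑-divisible n 1≤n α))
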